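{- Let $q,t$ be indeterminates. For every nonempty partition $\mu$, \[ (1-q^{|\mu|})\,m_{\mu}\left[\frac{1-t}{1-q}\right]=\sum_{i:\ m_i(\mu)\neq0}(1-t^i)\,m_{\mu\setminus\{i\}}\left[\frac{q-t}{1-q}\right], \] with $m_\emptyset=1$.
   Context: $m_\mu$ is the monomial symmetric function. $f\left[\frac{1-t}{1-q}\right]$ (resp. $f\left[\frac{q-t}{1-q}\right]$) is the image of a symmetric function $f$ under the algebra homomorphism sending the power sum $p_k$ to $\frac{1-t^k}{1-q^k}$ (resp. $\frac{q^k-t^k}{1-q^k}$). $m_i(\mu)$ is the multiplicity of $i$ in $\mu$, $|\mu|$ the sum of parts, $\mu\setminus\{i\}$ the partition obtained by removing one part equal to $i$. -}

module Defs where

open import Data.Nat as ℕ using (ℕ; zero; suc; _∸_; _⊓_; _≤?_; _≟_)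
open import Data.Nat.Divisibility using (_∣?_)
open import Data.Integer using (+_)
open import Data.Rational as ℚ using (ℚ; 0ℚ; 1ℚ)
open import Data.List using (List; []; _∷_; map; concatMap; upTo; foldr; _++_; deduplicate)
open import Data.List.Relation.Unary.All using (All)
open import Data.List.Relation.Unary.Linked using (Linked)
open import Data.Bool using (Bool; true; false; if_then_else_; _∧_)
open import Relation.Nullary.Decidable using (does)
open import Relation.Binary.PropositionalEquality using (_≡_)

-- Formal power series in two commuting indeterminates q, t over ℚ:
-- a series is its coefficient function  (a , b) ↦ [q^a t^b].
-- Rational functions of q,t whose denominators are products of
-- factors (1 - q^k) embed injectively into this ring, so identities
-- between them may be checked here.

Series : Set
Series = ℕ → ℕ → ℚ

_≈_ : Series → Series → Set
f ≈ g = ∀ a b → f a b ≡ g a b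

infix 4 _≈_
infixl 6 _⊕_ _⊖_
infixl 7 _⊛_ _·_

ℕ→ℚ : ℕ → ℚ
ℕ→ℚ n = (+ n) ℚ./ 1

𝟙 : Bool → ℚ
𝟙 b = if b then 1ℚ else 0ℚ

Σℚ : List ℚ → ℚ
Σℚ = foldr ℚ._+_ 0ℚ

_⊕_ : Series → Series → Series
(f ⊕ g) a b = f a b ℚ.+ g a b

_⊖_ : Series → Series → Series
(f ⊖ g) a b = f a b ℚ.- g a b

_·_ : ℚ → Series → Series
(c · f) a b = c ℚ.* f a b

_⊛_ : Series → Series → Series
(f ⊛ g) a b =
  Σℚ (map (λ i → Σℚ (map (λ j → f i j ℚ.* g (a ∸ i) (b ∸ j)) (upTo (suc b))))
          (upTo (suc a)))

0ₛ : Series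
0ₛ a b = 0ℚ

mono : ℕ → ℕ → Series
mono i j a b = 𝟙 (does (a ≟ i) ∧ does (b ≟ j))

1ₛ : Series
1ₛ = mono 0 0

Σₛ : List Series → Series
Σₛ = foldr _⊕_ 0ₛ

Πₛ : List Series → Series
Πₛ = foldr _⊛_ 1ₛ

-- geometric series  1/(1 - q^k) = Σ_{j ≥ 0} q^{k j}   (k ≥ 1)
geom : ℕ → Series
geom k a b = 𝟙 (does (k ∣? a) ∧ does (b ≟ 0))

-- images of the power sum p_k under the two plethystic substitutions
-- p_k ↦ (1 - t^k)/(1 - q^k)   and   p_k ↦ (q^k - t^k)/(1 - q^k)
pA : ℕ → Series
pA k = (mono 0 0 ⊖ mono 0 k) ⊛ geom k

pB : ℕ → Series
pB k = (mono k 0 ⊖ mono 0 k) ⊛ geom k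

IsPartition : List ℕ → Set
IsPartition μ = All (λ x → 1 ℕ.≤ x) μ × Linked ℕ._≥_ μ
  where open import Data.Product using (_×_)

size : List ℕ → ℕ
size = foldr ℕ._+_ 0

-- partitions of n with all parts ≤ k (fuel f ≥ n)
partitionsLE : (f n k : ℕ) → List (List ℕ)
partitionsLE zero    zero    k = [] ∷ []
partitionsLE zero    (suc n) k = []
partitionsLE (suc f) zero    k = [] ∷ []
partitionsLE (suc f) (suc n) k =
  concatMap (λ j → map (j ∷_) (partitionsLE f (suc n ∸ j) j))
            (map suc (upTo (k ⊓ suc n)))

partitions : ℕ → List (List ℕ)
partitions n = partitionsLE n n n

-- the possible ways of placing a part of size l into one of the bins,
-- given the remaining capacities of the bins
choices : ℕ → List ℕ → List (List ℕ)
choices l [] = []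
choices l (c ∷ cs) =
  (if does (l ≤? c) then ((c ∸ l) ∷ cs) ∷ [] else [])
  ++ map (c ∷_) (choices l cs)

allZero : List ℕ → Bool
allZero [] = true
allZero (c ∷ cs) = does (c ≟ 0) ∧ allZero cs

-- pm λ μ = number of maps φ : {1..ℓ(λ)} → {1..ℓ(μ)} with
-- Σ_{φ(j) = i} λ_j = μ_i for all i,  i.e. the coefficient of m_μ
-- in the expansion of the power sum p_λ in the monomial basis:
--   p_λ = Σ_{μ ⊢ |λ|} pm λ μ · m_μ .
pm : List ℕ → List ℕ → ℕ
pm [] caps = if allZero caps then 1 else 0
pm (l ∷ λ') caps = size (map (pm λ') (choices l caps))

-- M is the image of the monomial basis under the ring homomorphism
-- Λ_ℚ → Series determined by p_k ↦ img k, i.e. p_λ ↦ Π_j img λ_j.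
-- (Since p_λ = Σ_μ pm λ μ m_μ with an invertible triangular matrix over ℚ,
-- this determines M uniquely on partitions.)
IsMonomialImage : (ℕ → Series) → (List ℕ → Series) → Set
IsMonomialImage img M =
  ∀ λ' → IsPartition λ' →
    Πₛ (map img λ') ≈ Σₛ (map (λ μ → ℕ→ℚ (pm λ' μ) · M μ) (partitions (size λ')))

removeOne : ℕ → List ℕ → List ℕ
removeOne i [] = []
removeOne i (x ∷ xs) = if does (i ≟ x) then xs else x ∷ removeOne i xs

distinctParts : List ℕ → List ℕ
distinctParts = deduplicate _≟_

{-# OPTIONS --safe #-}
module Submission where

-- Write p_λ = Σ_ν pm λ ν m_ν. Since pm is triangular with respect to the number of
-- parts and has a nonzero diagonal, it suffices to show that both sides, viewed as
-- functions of μ ⊢ n, have the same pairing Σ_ν pm λ ν (·) with every λ ⊢ n.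
-- On the left the pairing is (1 - q^n) p_λ[A], where A = (1 - t)/(1 - q).
-- On the right, write ν = ρ ∪ {i} and split the parts of λ into those that fill the
-- part i and the rest: the pairing becomes Σ_S (1 - t^|S|) p_{λ∖S}[B] over the
-- subsets S of the parts of λ, where B = (q - t)/(1 - q), i.e.
-- Π_j (1 + p_{λ_j}[B]) - Π_j (t^{λ_j} + p_{λ_j}[B]).
-- Now 1 + p_k[B] = p_k[A] and t^k + p_k[B] = q^k p_k[A], so this is (1 - q^n) p_λ[A].

open import Defs

open import Algebra.Bundles using (CommutativeSemigroup)
import Algebra.Properties.CommutativeSemigroup as CommutativeSemigroupProperties
open import Algebra.Structures using (IsCommutativeMonoid)
open import Data.Bool using (Bool; true; false; _∧_; if_then_else_)
open import Data.Empty using (⊥-elim)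
import Data.Integer as ℤ
import Data.Integer.Properties as ℤP
open import Data.List using (List; []; _∷_; map; _++_; concatMap; foldr; upTo; length)
import Data.List.Properties as List
open import Data.List.Membership.Propositional using (_∈_; _∉_; _─_; find; lose)
open import Data.List.Membership.Propositional.Properties using (∈-upTo⁺; ∈-upTo⁻; ∈-map⁺; ∈-map⁻; ∈-++⁻; ∈-concatMap⁺; ∈-concatMap⁻; ∈-deduplicate⁺; ∈-deduplicate⁻)
open import Data.List.Relation.Binary.Disjoint.Propositional using (Disjoint)
open import Data.List.Relation.Binary.Equality.Propositional using (≋⇒≡)
open import Data.List.Relation.Binary.Permutation.Propositional using (_↭_; ↭-refl; ↭-sym; ↭-trans; prep; swap; ↭⇒↭ₛ)
open import Data.List.Relation.Binary.Permutation.Propositional.Properties using (All-resp-↭; ∈-resp-↭)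
open import Data.List.Relation.Binary.Sublist.Propositional using (_⊆_; []; _∷_; _∷ʳ_)
open import Data.List.Relation.Binary.Sublist.Propositional.Properties using (All-resp-⊆)
open import Data.List.Relation.Unary.All using (All; []; _∷_)
import Data.List.Relation.Unary.All as All
import Data.List.Relation.Unary.All.Properties as All
open import Data.List.Relation.Unary.AllPairs using (AllPairs; []; _∷_)
open import Data.List.Relation.Unary.Any using (here; there)
open import Data.List.Relation.Unary.Linked using (Linked; []; [-]; _∷_)
import Data.List.Relation.Unary.Linked as Linked
open import Data.List.Relation.Unary.Linked.Properties using (Linked⇒All; Linked⇒AllPairs; AllPairs⇒Linked)
open import Data.List.Relation.Unary.Sorted.TotalOrder.Properties using (↗↭↗⇒≋)
open import Data.List.Relation.Unary.Unique.Propositional using (Unique)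
import Data.List.Relation.Unary.Unique.Propositional.Properties as Unique
open import Data.Nat as ℕ using (ℕ; zero; suc; _∸_; _≤_; _<_; z≤n; s≤s; _≤?_; _≟_; _⊓_)
import Data.Nat.Coprimality as Coprimality
open import Data.Nat.Divisibility using (_∣_; _∣?_; _∣0; ∣m+n∣m⇒∣n; ∣m∸n∣n⇒∣m; ∣⇒≤; ∣-refl)
open import Data.Nat.ListAction.Properties using (sum-↭)
import Data.Nat.Properties as ℕP
open import Data.Product using (_×_; _,_; proj₁; proj₂; map₁; map₂; ∃)
import Data.Product.Properties as Product
open import Data.Rational as ℚ using (ℚ; 0ℚ; 1ℚ; mkℚ; _*_)
import Data.Rational.Properties as ℚP
open import Data.Rational.Solver using (module +-*-Solver)
open import Data.Sum using (_⊎_; inj₁; inj₂)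
open import Function using (_∘_)
open import Level using (0ℓ)
open import Relation.Binary.Bundles using (DecTotalOrder; Setoid)
open import Relation.Binary.PropositionalEquality
import Relation.Binary.Reasoning.Setoid as SetoidReasoning
open import Relation.Nullary using (yes; no; ¬_; does; Dec)
open import Relation.Nullary.Decidable using (dec-true; dec-false)

open import Algebra.Properties.Group ℚP.+-0-group using (x∙y⁻¹≈ε⇒x≈y)
open import Data.List.Relation.Unary.Unique.DecPropositional.Properties ℕ._≟_ using (deduplicate-!)
open import Relation.Binary.Properties.DecTotalOrder ℕP.≤-decTotalOrder using (≥-decTotalOrder)
open import Data.List.Sort.InsertionSort.Base ≥-decTotalOrder using (insert)
open import Data.List.Sort.InsertionSort.Properties ≥-decTotalOrder using (insert-↭; insert-↗)
open +-*-Solver using (solve; _:+_; _:-_; _:*_; _:=_)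

private variable
  A B : Set

module _ {x : A} where

  ∈-─⁻ : ∀ {xs z} (p : x ∈ xs) → z ∈ xs ─ p → z ∈ xs
  ∈-─⁻ (here _) q = there q
  ∈-─⁻ (there p) (here e) = here e
  ∈-─⁻ (there p) (there q) = there (∈-─⁻ p q)

  ∈-─⁺ : ∀ {xs z} (p : x ∈ xs) → z ∈ xs → z ≢ x → z ∈ xs ─ p
  ∈-─⁺ (here refl) (here refl) z≢x = ⊥-elim (z≢x refl)
  ∈-─⁺ (here refl) (there q) _ = q
  ∈-─⁺ (there p) (here e) _ = here e
  ∈-─⁺ (there p) (there q) z≢x = there (∈-─⁺ p q z≢x)

  Unique-─ : ∀ {xs} (p : x ∈ xs) → Unique xs → Unique (xs ─ p)
  Unique-─ (here _) (_ ∷ u) = u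
  Unique-─ (there p) (d ∷ u) = All.─⁺ p d ∷ Unique-─ p u

  ∉-─ : ∀ {xs} (p : x ∈ xs) → Unique xs → x ∉ xs ─ p
  ∉-─ (here refl) (d ∷ _) q = All.lookup d q refl
  ∉-─ (there p) (d ∷ _) (here refl) = All.lookup d p refl
  ∉-─ (there p) (_ ∷ u) (there q) = ∉-─ p u q

∈-if-[]⁻ : ∀ {P : Set} (p? : Dec P) {x y : A} → y ∈ (if does p? then x ∷ [] else []) → P × y ≡ x
∈-if-[]⁻ (yes p) (here refl) = p , refl

Unique-concatMap⁺ : ∀ (g : A → List B) {xs} → Unique xs → (∀ x → Unique (g x)) →
                    (∀ {x y z} → z ∈ g x → z ∈ g y → x ≡ y) → Unique (concatMap g xs)
Unique-concatMap⁺ g {[]} _ _ _ = []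
Unique-concatMap⁺ g {x ∷ xs} (x∉xs ∷ uxs) ug g-disjoint =
  Unique.++⁺ (ug x) (Unique-concatMap⁺ g uxs ug g-disjoint) disjoint
  where
  disjoint : Disjoint (g x) (concatMap g xs)
  disjoint (z∈gx , z∈rest) with y , y∈xs , z∈gy ← find (∈-concatMap⁻ g z∈rest) =
    All.lookup x∉xs y∈xs (g-disjoint z∈gx z∈gy)

AllPairs-resp-⊆ : ∀ {R : A → A → Set} {xs ys} → xs ⊆ ys → AllPairs R ys → AllPairs R xs
AllPairs-resp-⊆ [] [] = []
AllPairs-resp-⊆ (_ ∷ʳ xs⊆ys) (_ ∷ pys) = AllPairs-resp-⊆ xs⊆ys pys
AllPairs-resp-⊆ (refl ∷ xs⊆ys) (py ∷ pys) =
  All-resp-⊆ xs⊆ys py ∷ AllPairs-resp-⊆ xs⊆ys pys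

module ListSum {C : Set} {_+_ : C → C → C} {0# : C}
               (isCommutativeMonoid : IsCommutativeMonoid _≡_ _+_ 0#) where

  open IsCommutativeMonoid isCommutativeMonoid using (assoc; identityˡ; identityʳ)

  private
    +-commutativeSemigroup : CommutativeSemigroup 0ℓ 0ℓ
    +-commutativeSemigroup = record
      { isCommutativeSemigroup = IsCommutativeMonoid.isCommutativeSemigroup isCommutativeMonoid }

  open CommutativeSemigroupProperties +-commutativeSemigroup using (interchange; x∙yz≈y∙xz)
  open ≡-Reasoning

  ∑ : (A → C) → List A → C
  ∑ f xs = foldr _+_ 0# (map f xs)

  ∑-cong : ∀ {f g : A → C} xs → (∀ x → f x ≡ g x) → ∑ f xs ≡ ∑ g xs
  ∑-cong xs f≗g = cong (foldr _+_ 0#) (List.map-cong f≗g xs)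

  ∑-cong-∈ : ∀ {f g : A → C} xs → (∀ {x} → x ∈ xs → f x ≡ g x) → ∑ f xs ≡ ∑ g xs
  ∑-cong-∈ [] _ = refl
  ∑-cong-∈ (x ∷ xs) f≗g = cong₂ _+_ (f≗g (here refl)) (∑-cong-∈ xs (f≗g ∘ there))

  ∑-++ : ∀ (f : A → C) xs ys → ∑ f (xs ++ ys) ≡ ∑ f xs + ∑ f ys
  ∑-++ f [] ys = sym (identityˡ _)
  ∑-++ f (x ∷ xs) ys = trans (cong (f x +_) (∑-++ f xs ys)) (sym (assoc (f x) _ _))

  ∑-map : ∀ (f : B → C) (g : A → B) xs → ∑ f (map g xs) ≡ ∑ (f ∘ g) xs
  ∑-map f g xs = cong (foldr _+_ 0#) (sym (List.map-∘ xs))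

  ∑-concatMap : ∀ (f : B → C) (g : A → List B) xs →
                ∑ f (concatMap g xs) ≡ ∑ (λ x → ∑ f (g x)) xs
  ∑-concatMap f g [] = refl
  ∑-concatMap f g (x ∷ xs) =
    trans (∑-++ f (g x) (concatMap g xs)) (cong (∑ f (g x) +_) (∑-concatMap f g xs))

  ∑-zero : ∀ {f : A → C} xs → (∀ {x} → x ∈ xs → f x ≡ 0#) → ∑ f xs ≡ 0#
  ∑-zero [] _ = refl
  ∑-zero (x ∷ xs) f≗0 = trans (cong₂ _+_ (f≗0 (here refl)) (∑-zero xs (f≗0 ∘ there))) (identityˡ 0#)

  ∑-distrib-+ : ∀ (f g : A → C) xs → ∑ (λ x → f x + g x) xs ≡ ∑ f xs + ∑ g xs
  ∑-distrib-+ f g [] = sym (identityˡ 0#)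
  ∑-distrib-+ f g (x ∷ xs) =
    trans (cong ((f x + g x) +_) (∑-distrib-+ f g xs)) (interchange (f x) (g x) (∑ f xs) (∑ g xs))

  ∑-comm : ∀ (h : A → B → C) xs ys →
           ∑ (λ x → ∑ (h x) ys) xs ≡ ∑ (λ y → ∑ (λ x → h x y) xs) ys
  ∑-comm h [] ys = sym (∑-zero ys (λ _ → refl))
  ∑-comm h (x ∷ xs) ys =
    trans (cong (∑ (h x) ys +_) (∑-comm h xs ys)) (sym (∑-distrib-+ (h x) _ ys))

  ∑-hom : ∀ (φ : C → C) → φ 0# ≡ 0# → (∀ u v → φ (u + v) ≡ φ u + φ v) →
          ∀ (f : A → C) xs → φ (∑ f xs) ≡ ∑ (φ ∘ f) xs
  ∑-hom φ φ-0 φ-+ f [] = φ-0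
  ∑-hom φ φ-0 φ-+ f (x ∷ xs) = trans (φ-+ (f x) (∑ f xs)) (cong (φ (f x) +_) (∑-hom φ φ-0 φ-+ f xs))

  ∑-─ : ∀ (f : A → C) {x xs} (p : x ∈ xs) → ∑ f xs ≡ f x + ∑ f (xs ─ p)
  ∑-─ f (here refl) = refl
  ∑-─ f {x} {y ∷ ys} (there p) = begin
    f y + ∑ f ys                ≡⟨ cong (f y +_) (∑-─ f p) ⟩
    f y + (f x + ∑ f (ys ─ p))  ≡⟨ x∙yz≈y∙xz (f y) (f x) _ ⟩
    f x + (f y + ∑ f (ys ─ p))  ∎

  ∑-Unique-same-elements : ∀ (f : A → C) {xs ys} → Unique xs → Unique ys →
                           (∀ {z} → z ∈ xs → z ∈ ys) → (∀ {z} → z ∈ ys → z ∈ xs) →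
                           ∑ f xs ≡ ∑ f ys
  ∑-Unique-same-elements f {[]} {[]} _ _ _ _ = refl
  ∑-Unique-same-elements f {[]} {y ∷ ys} _ _ _ ys⊆xs with () ← ys⊆xs (here refl)
  ∑-Unique-same-elements f {x ∷ xs} {ys} (x∉xs ∷ uxs) uys xs⊆ys ys⊆xs =
    trans (cong (f x +_) (∑-Unique-same-elements f uxs (Unique-─ x∈ys uys) xs⊆ys─ ys─⊆xs))
          (sym (∑-─ f x∈ys))
    where
    x∈ys : x ∈ ys
    x∈ys = xs⊆ys (here refl)
    xs⊆ys─ : ∀ {z} → z ∈ xs → z ∈ ys ─ x∈ys
    xs⊆ys─ z∈xs = ∈-─⁺ x∈ys (xs⊆ys (there z∈xs)) (λ { refl → All.lookup x∉xs z∈xs refl })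
    ys─⊆xs : ∀ {z} → z ∈ ys ─ x∈ys → z ∈ xs
    ys─⊆xs z∈ys─ with ys⊆xs (∈-─⁻ x∈ys z∈ys─)
    ... | here refl = ⊥-elim (∉-─ x∈ys uys z∈ys─)
    ... | there z∈xs = z∈xs

  ∑-single : ∀ (f : A → C) {x xs} → Unique xs → x ∈ xs →
             (∀ {z} → z ∈ xs → z ≢ x → f z ≡ 0#) → ∑ f xs ≡ f x
  ∑-single f {x} {xs} u x∈xs others = begin
    ∑ f xs                  ≡⟨ ∑-─ f x∈xs ⟩
    f x + ∑ f (xs ─ x∈xs)   ≡⟨ cong (f x +_) (∑-zero (xs ─ x∈xs) others′) ⟩
    f x + 0#                ≡⟨ identityʳ (f x) ⟩
    f x                     ∎
    where
    others′ : ∀ {z} → z ∈ xs ─ x∈xs → f z ≡ 0#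
    others′ z∈ = others (∈-─⁻ x∈xs z∈) λ { refl → ∉-─ x∈xs u z∈ }

open ListSum ℚP.+-0-isCommutativeMonoid
module ℕ∑ = ListSum ℕP.+-0-isCommutativeMonoid

module ℕ+ = CommutativeSemigroupProperties ℕP.+-commutativeSemigroup

ℕ∑-if : ∀ b (f : A → ℕ) xs → ℕ∑.∑ (λ x → if b then f x else 0) xs ≡ (if b then ℕ∑.∑ f xs else 0)
ℕ∑-if true f xs = refl
ℕ∑-if false f xs = ℕ∑.∑-zero xs (λ _ → refl)

ℕ∑-if-singleton : ∀ x b (f : A → ℕ) → ℕ∑.∑ f (if b then x ∷ [] else []) ≡ (if b then f x else 0)
ℕ∑-if-singleton x true f = ℕP.+-identityʳ (f x)
ℕ∑-if-singleton x false f = refl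

ℕ∑-≢0⇒∃ : ∀ (f : A → ℕ) xs → ℕ∑.∑ f xs ≢ 0 → ∃ λ x → x ∈ xs × f x ≢ 0
ℕ∑-≢0⇒∃ f [] ∑≢0 = ⊥-elim (∑≢0 refl)
ℕ∑-≢0⇒∃ f (x ∷ xs) ∑≢0 with f x ≟ 0
... | no fx≢0 = x , here refl , fx≢0
... | yes fx≡0 with y , y∈xs , fy≢0 ← ℕ∑-≢0⇒∃ f xs (λ ∑≡0 → ∑≢0 (cong₂ ℕ._+_ fx≡0 ∑≡0)) =
  y , there y∈xs , fy≢0

*-distribˡ-- : ∀ x y z → x * (y ℚ.- z) ≡ x * y ℚ.- x * z
*-distribˡ-- = solve 3 (λ x y z → x :* (y :- z) := x :* y :- x :* z) refl

x*y≡0⇒y≡0 : ∀ x y → x ≢ 0ℚ → x * y ≡ 0ℚ → y ≡ 0ℚ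
x*y≡0⇒y≡0 x y x≢0 xy≡0 = begin
  y                 ≡⟨ ℚP.*-identityˡ y ⟨
  1ℚ * y            ≡⟨ cong (_* y) (ℚP.*-inverseˡ x) ⟨
  (ℚ.1/ x * x) * y  ≡⟨ ℚP.*-assoc (ℚ.1/ x) x y ⟩
  ℚ.1/ x * (x * y)  ≡⟨ cong (ℚ.1/ x *_) xy≡0 ⟩
  ℚ.1/ x * 0ℚ       ≡⟨ ℚP.*-zeroʳ (ℚ.1/ x) ⟩
  0ℚ                ∎
  where
  open ≡-Reasoning
  instance
    x-nonZero : ℚ.NonZero x
    x-nonZero = ℚ.≢-nonZero x≢0

∑-*ˡ : ∀ c (f : A → ℚ) xs → c * ∑ f xs ≡ ∑ (λ x → c * f x) xs
∑-*ˡ c = ∑-hom (c *_) (ℚP.*-zeroʳ c) (ℚP.*-distribˡ-+ c)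

∑-*ʳ : ∀ c (f : A → ℚ) xs → ∑ f xs * c ≡ ∑ (λ x → f x * c) xs
∑-*ʳ c = ∑-hom (_* c) (ℚP.*-zeroˡ c) (λ u v → ℚP.*-distribʳ-+ c u v)

∑-distrib-- : ∀ (f g : A → ℚ) xs → ∑ (λ x → f x ℚ.- g x) xs ≡ ∑ f xs ℚ.- ∑ g xs
∑-distrib-- f g xs =
  trans (∑-distrib-+ f (ℚ.-_ ∘ g) xs) (cong (∑ f xs ℚ.+_) (sym (∑-hom ℚ.-_ refl ℚP.neg-distrib-+ g xs)))

ℕ→ℚ≡mkℚ : ∀ n → ℕ→ℚ n ≡ mkℚ (ℤ.+ n) 0 (Coprimality.sym (Coprimality.1-coprimeTo n))
ℕ→ℚ≡mkℚ n = ℚP.normalize-coprime (Coprimality.sym (Coprimality.1-coprimeTo n))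

ℕ→ℚ-+ : ∀ m n → ℕ→ℚ (m ℕ.+ n) ≡ ℕ→ℚ m ℚ.+ ℕ→ℚ n
ℕ→ℚ-+ m n rewrite ℕ→ℚ≡mkℚ m | ℕ→ℚ≡mkℚ n =
  cong₂ (λ a b → (a ℤ.+ b) ℚ./ 1) (sym (ℤP.*-identityʳ (ℤ.+ m))) (sym (ℤP.*-identityʳ (ℤ.+ n)))

ℕ→ℚ-∑ : ∀ (f : A → ℕ) xs → ℕ→ℚ (ℕ∑.∑ f xs) ≡ ∑ (ℕ→ℚ ∘ f) xs
ℕ→ℚ-∑ f [] = refl
ℕ→ℚ-∑ f (x ∷ xs) = trans (ℕ→ℚ-+ (f x) (ℕ∑.∑ f xs)) (cong (ℕ→ℚ (f x) ℚ.+_) (ℕ→ℚ-∑ f xs))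

ℕ→ℚ-suc≢0 : ∀ n → ℕ→ℚ (suc n) ≢ 0ℚ
ℕ→ℚ-suc≢0 n eq with () ← trans (sym (ℕ→ℚ≡mkℚ (suc n))) eq

ℕ→ℚ-if : ∀ b n → ℕ→ℚ (if b then n else 0) ≡ 𝟙 b * ℕ→ℚ n
ℕ→ℚ-if true n = sym (ℚP.*-identityˡ (ℕ→ℚ n))
ℕ→ℚ-if false n = sym (ℚP.*-zeroˡ (ℕ→ℚ n))

-- Power series in q and t

≈-refl : ∀ {f} → f ≈ f
≈-refl _ _ = refl

≈-sym : ∀ {f g} → f ≈ g → g ≈ f
≈-sym f≈g a b = sym (f≈g a b)

≈-trans : ∀ {f g h} → f ≈ g → g ≈ h → f ≈ h
≈-trans f≈g g≈h a b = trans (f≈g a b) (g≈h a b)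

≈-setoid : Setoid _ _
≈-setoid = record
  { Carrier = Series
  ; _≈_ = _≈_
  ; isEquivalence = record { refl = ≈-refl ; sym = ≈-sym ; trans = ≈-trans }
  }

module ≈-Reasoning = SetoidReasoning ≈-setoid

∑≤ : ℕ → (ℕ → ℚ) → ℚ
∑≤ n F = ∑ F (upTo (suc n))

∑≤-cong-≤ : ∀ n {F G : ℕ → ℚ} → (∀ {i} → i ≤ n → F i ≡ G i) → ∑≤ n F ≡ ∑≤ n G
∑≤-cong-≤ n F≗G = ∑-cong-∈ (upTo (suc n)) (λ i∈ → F≗G (ℕ.s≤s⁻¹ (∈-upTo⁻ i∈)))

∑≤-head : ∀ n F → ∑≤ n F ≡ F 0 ℚ.+ ∑ F (map suc (upTo n))
∑≤-head n F = cong (λ xs → F 0 ℚ.+ ∑ F xs) (sym (List.map-upTo suc n))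

∑≤-sucʳ : ∀ n F → ∑≤ (suc n) F ≡ ∑≤ n F ℚ.+ F (suc n)
∑≤-sucʳ n F = begin
  ∑ F (upTo (suc (suc n)))           ≡⟨ cong (∑ F) (sym (List.upTo-∷ʳ (suc n))) ⟩
  ∑ F (upTo (suc n) ++ suc n ∷ [])   ≡⟨ ∑-++ F (upTo (suc n)) _ ⟩
  ∑≤ n F ℚ.+ (F (suc n) ℚ.+ 0ℚ)      ≡⟨ cong (∑≤ n F ℚ.+_) (ℚP.+-identityʳ _) ⟩
  ∑≤ n F ℚ.+ F (suc n)               ∎
  where open ≡-Reasoning

∑≤-reverse : ∀ n F → ∑≤ n F ≡ ∑≤ n (λ i → F (n ∸ i))
∑≤-reverse zero F = refl
∑≤-reverse (suc n) F = begin
  ∑≤ (suc n) F                                      ≡⟨ ∑≤-head (suc n) F ⟩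
  F 0 ℚ.+ ∑ F (map suc (upTo (suc n)))              ≡⟨ cong (F 0 ℚ.+_) (∑-map F suc (upTo (suc n))) ⟩
  F 0 ℚ.+ ∑≤ n (F ∘ suc)                            ≡⟨ cong (F 0 ℚ.+_) (∑≤-reverse n (F ∘ suc)) ⟩
  F 0 ℚ.+ ∑≤ n (λ i → F (suc (n ∸ i)))              ≡⟨ ℚP.+-comm (F 0) _ ⟩
  ∑≤ n (λ i → F (suc (n ∸ i))) ℚ.+ F 0              ≡⟨ cong₂ ℚ._+_ (∑≤-cong-≤ n (λ i≤n → cong F (sym (ℕP.+-∸-assoc 1 i≤n))))
                                                                   (cong F (sym (ℕP.n∸n≡0 n))) ⟩
  ∑≤ n (λ i → F (suc n ∸ i)) ℚ.+ F (suc n ∸ suc n)  ≡⟨ sym (∑≤-sucʳ n (λ i → F (suc n ∸ i))) ⟩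
  ∑≤ (suc n) (λ i → F (suc n ∸ i))                  ∎
  where open ≡-Reasoning

∑≤-extend : ∀ {c} n (F : ℕ → ℚ) → c ≤ n → (∀ {i} → c < i → i ≤ n → F i ≡ 0ℚ) → ∑≤ n F ≡ ∑≤ c F
∑≤-extend n F c≤n F≡0 with ℕP.m≤n⇒m<n∨m≡n c≤n
... | inj₂ refl = refl
∑≤-extend zero F _ _ | inj₁ ()
∑≤-extend {c} (suc n) F _ F≡0 | inj₁ (s≤s c≤n) = begin
  ∑≤ (suc n) F          ≡⟨ ∑≤-sucʳ n F ⟩
  ∑≤ n F ℚ.+ F (suc n)  ≡⟨ cong₂ ℚ._+_ (∑≤-extend n F c≤n (λ c<i i≤n → F≡0 c<i (ℕP.m≤n⇒m≤1+n i≤n)))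
                                       (F≡0 (s≤s c≤n) ℕP.≤-refl) ⟩
  ∑≤ c F ℚ.+ 0ℚ         ≡⟨ ℚP.+-identityʳ _ ⟩
  ∑≤ c F                ∎
  where open ≡-Reasoning

guard≤ : ℕ → ℕ → ℚ → ℚ
guard≤ k n x with k ≤? n
... | yes _ = x
... | no _ = 0ℚ

guard≤-yes : ∀ {k n} x → k ≤ n → guard≤ k n x ≡ x
guard≤-yes {k} {n} x k≤n with k ≤? n
... | yes _ = refl
... | no k≰n = ⊥-elim (k≰n k≤n)

guard≤-no : ∀ {k n} x → ¬ k ≤ n → guard≤ k n x ≡ 0ℚ
guard≤-no {k} {n} x k≰n with k ≤? n
... | yes k≤n = ⊥-elim (k≰n k≤n)
... | no _ = refl

∑-guard≤ : ∀ k n (F : A → ℚ) xs → ∑ (λ x → guard≤ k n (F x)) xs ≡ guard≤ k n (∑ F xs)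
∑-guard≤ k n F xs with k ≤? n
... | yes _ = refl
... | no _ = ∑-zero xs (λ _ → refl)

*-guard≤ : ∀ k n x y → x * guard≤ k n y ≡ guard≤ k n (x * y)
*-guard≤ k n x y with k ≤? n
... | yes _ = refl
... | no _ = ℚP.*-zeroʳ x

guard≤-* : ∀ k n x y → guard≤ k n x * y ≡ guard≤ k n (x * y)
guard≤-* k n x y with k ≤? n
... | yes _ = refl
... | no _ = ℚP.*-zeroˡ y

guard≤-comm : ∀ k m l n x → guard≤ k m (guard≤ l n x) ≡ guard≤ l n (guard≤ k m x)
guard≤-comm k m l n x with k ≤? m | l ≤? n
... | yes _ | yes _ = refl
... | yes _ | no _ = refl
... | no _ | yes _ = refl
... | no _ | no _ = refl

guard≤-guard≤ : ∀ k l n x → guard≤ k n (guard≤ l (n ∸ k) x) ≡ guard≤ (k ℕ.+ l) n x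
guard≤-guard≤ k l n x with k ≤? n | k ℕ.+ l ≤? n
... | yes k≤n | yes k+l≤n =
  guard≤-yes x (ℕP.m+n≤o⇒m≤o∸n l (subst (_≤ n) (ℕP.+-comm k l) k+l≤n))
... | yes k≤n | no k+l≰n =
  guard≤-no x (λ l≤n∸k → k+l≰n (subst (_≤ n) (ℕP.+-comm l k) (ℕP.m≤o∸n⇒m+n≤o l k≤n l≤n∸k)))
... | no k≰n | yes k+l≤n = ⊥-elim (k≰n (ℕP.≤-trans (ℕP.m≤m+n k l) k+l≤n))
... | no _ | no _ = refl

∑≤-guard≤-∸ : ∀ k n (G : ℕ → ℚ) → ∑≤ n (λ i → guard≤ k (n ∸ i) (G i)) ≡ guard≤ k n (∑≤ (n ∸ k) G)
∑≤-guard≤-∸ k n G = by-cases (k ≤? n)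
  where
  by-cases : Dec (k ≤ n) → ∑≤ n (λ i → guard≤ k (n ∸ i) (G i)) ≡ guard≤ k n (∑≤ (n ∸ k) G)
  by-cases (no k≰n) = trans (∑-zero (upTo (suc n)) (λ {i} _ → guard≤-no (G i) (k≰n ∘ k≤n∸i⇒k≤n i)))
                            (sym (guard≤-no _ k≰n))
    where
    k≤n∸i⇒k≤n : ∀ i → k ≤ n ∸ i → k ≤ n
    k≤n∸i⇒k≤n i k≤n∸i = ℕP.≤-trans k≤n∸i (ℕP.m∸n≤m n i)
  by-cases (yes k≤n) = begin
    ∑≤ n (λ i → guard≤ k (n ∸ i) (G i))        ≡⟨ ∑≤-extend n _ (ℕP.m∸n≤m n k) outside ⟩
    ∑≤ (n ∸ k) (λ i → guard≤ k (n ∸ i) (G i))  ≡⟨ ∑≤-cong-≤ (n ∸ k) inside ⟩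
    ∑≤ (n ∸ k) G                               ≡⟨ guard≤-yes _ k≤n ⟨
    guard≤ k n (∑≤ (n ∸ k) G)                  ∎
    where
    open ≡-Reasoning
    outside : ∀ {i} → n ∸ k < i → i ≤ n → guard≤ k (n ∸ i) (G i) ≡ 0ℚ
    outside {i} n∸k<i i≤n = guard≤-no (G i) λ k≤n∸i →
      ℕP.<⇒≱ n∸k<i (ℕP.m+n≤o⇒m≤o∸n i (subst (_≤ n) (ℕP.+-comm k i) (ℕP.m≤o∸n⇒m+n≤o k i≤n k≤n∸i)))
    inside : ∀ {i} → i ≤ n ∸ k → guard≤ k (n ∸ i) (G i) ≡ G i
    inside {i} i≤n∸k = guard≤-yes (G i)
      (ℕP.m+n≤o⇒m≤o∸n k (subst (_≤ n) (ℕP.+-comm i k) (ℕP.m≤o∸n⇒m+n≤o i k≤n i≤n∸k)))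

𝟙-≡-* : ∀ i j x → i ≡ j → 𝟙 (does (i ≟ j)) * x ≡ x
𝟙-≡-* i .i x refl rewrite dec-true (i ≟ i) refl = ℚP.*-identityˡ x

𝟙-≢-* : ∀ i j x → i ≢ j → 𝟙 (does (i ≟ j)) * x ≡ 0ℚ
𝟙-≢-* i j x i≢j rewrite dec-false (i ≟ j) i≢j = ℚP.*-zeroˡ x

𝟙-does-⇔ : ∀ {P Q : Set} (p? : Dec P) (q? : Dec Q) → (P → Q) → (Q → P) → 𝟙 (does p?) ≡ 𝟙 (does q?)
𝟙-does-⇔ (yes _) (yes _) _ _ = refl
𝟙-does-⇔ (yes p) (no ¬q) to _ = ⊥-elim (¬q (to p))
𝟙-does-⇔ (no ¬p) (yes q) _ from = ⊥-elim (¬p (from q))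
𝟙-does-⇔ (no _) (no _) _ _ = refl

𝟙-≟-sym : ∀ i j → 𝟙 (does (i ≟ j)) ≡ 𝟙 (does (j ≟ i))
𝟙-≟-sym i j = 𝟙-does-⇔ (i ≟ j) (j ≟ i) sym sym

𝟙-∧ : ∀ x y → 𝟙 (x ∧ y) ≡ 𝟙 x * 𝟙 y
𝟙-∧ true true = refl
𝟙-∧ true false = refl
𝟙-∧ false y = sym (ℚP.*-zeroˡ (𝟙 y))

∑≤-δ : ∀ n k (F : ℕ → ℚ) → ∑≤ n (λ i → 𝟙 (does (i ≟ k)) * F i) ≡ guard≤ k n (F k)
∑≤-δ n k F = by-cases (k ≤? n)
  where
  δF : ℕ → ℚ
  δF i = 𝟙 (does (i ≟ k)) * F i
  by-cases : Dec (k ≤ n) → ∑≤ n δF ≡ guard≤ k n (F k)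
  by-cases (yes k≤n) =
    trans (∑-single δF (Unique.upTo⁺ (suc n)) (∈-upTo⁺ (s≤s k≤n)) (λ {i} _ i≢k → 𝟙-≢-* i k (F i) i≢k))
          (trans (𝟙-≡-* k k (F k) refl) (sym (guard≤-yes _ k≤n)))
  by-cases (no k≰n) =
    trans (∑-zero (upTo (suc n)) (λ {i} i∈ → 𝟙-≢-* i k (F i) (λ { refl → k≰n (ℕ.s≤s⁻¹ (∈-upTo⁻ i∈)) })))
          (sym (guard≤-no _ k≰n))

∑-1…n-δ : ∀ n s (F : ℕ → ℚ) → s ≤ n → F 0 ≡ 0ℚ → ∑ (λ i → 𝟙 (does (s ≟ i)) * F i) (map suc (upTo n)) ≡ F s
∑-1…n-δ n s F s≤n F0≡0 = begin
  ∑ δF (map suc (upTo n))             ≡⟨ ℚP.+-identityˡ _ ⟨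
  0ℚ ℚ.+ ∑ δF (map suc (upTo n))      ≡⟨ cong (ℚ._+ ∑ δF (map suc (upTo n))) δF0≡0 ⟨
  δF 0 ℚ.+ ∑ δF (map suc (upTo n))    ≡⟨ ∑≤-head n δF ⟨
  ∑≤ n δF                             ≡⟨ ∑-cong (upTo (suc n)) (λ i → cong (_* F i) (𝟙-≟-sym s i)) ⟩
  ∑≤ n (λ i → 𝟙 (does (i ≟ s)) * F i) ≡⟨ ∑≤-δ n s F ⟩
  guard≤ s n (F s)                    ≡⟨ guard≤-yes (F s) s≤n ⟩
  F s                                 ∎
  where
  open ≡-Reasoning
  δF : ℕ → ℚ
  δF i = 𝟙 (does (s ≟ i)) * F i
  δF0≡0 : δF 0 ≡ 0ℚ
  δF0≡0 = trans (cong (𝟙 (does (s ≟ 0)) *_) F0≡0) (ℚP.*-zeroʳ (𝟙 (does (s ≟ 0))))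

∸-∸-comm : ∀ m n o → m ∸ n ∸ o ≡ m ∸ o ∸ n
∸-∸-comm m n o = begin
  m ∸ n ∸ o      ≡⟨ ℕP.∸-+-assoc m n o ⟩
  m ∸ (n ℕ.+ o)  ≡⟨ cong (m ∸_) (ℕP.+-comm n o) ⟩
  m ∸ (o ℕ.+ n)  ≡⟨ ℕP.∸-+-assoc m o n ⟨
  m ∸ o ∸ n      ∎
  where open ≡-Reasoning

⊛-cong : ∀ {f f′ g g′} → f ≈ f′ → g ≈ g′ → f ⊛ g ≈ f′ ⊛ g′
⊛-cong f≈f′ g≈g′ a b =
  ∑-cong (upTo (suc a)) (λ i → ∑-cong (upTo (suc b)) (λ j → cong₂ _*_ (f≈f′ i j) (g≈g′ (a ∸ i) (b ∸ j))))

⊛-congʳ : ∀ f {g g′} → g ≈ g′ → f ⊛ g ≈ f ⊛ g′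
⊛-congʳ f g≈g′ = ⊛-cong (≈-refl {f}) g≈g′

⊛-comm : ∀ f g → f ⊛ g ≈ g ⊛ f
⊛-comm f g a b = begin
  ∑≤ a (λ i → ∑≤ b (λ j → f i j * g (a ∸ i) (b ∸ j)))
    ≡⟨ ∑≤-reverse a (λ i → ∑≤ b (λ j → f i j * g (a ∸ i) (b ∸ j))) ⟩
  ∑≤ a (λ i → ∑≤ b (λ j → f (a ∸ i) j * g (a ∸ (a ∸ i)) (b ∸ j)))
    ≡⟨ ∑-cong (upTo (suc a)) (λ i → ∑≤-reverse b (λ j → f (a ∸ i) j * g (a ∸ (a ∸ i)) (b ∸ j))) ⟩
  ∑≤ a (λ i → ∑≤ b (λ j → f (a ∸ i) (b ∸ j) * g (a ∸ (a ∸ i)) (b ∸ (b ∸ j))))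
    ≡⟨ ∑≤-cong-≤ a (λ i≤a → ∑≤-cong-≤ b (λ j≤b → swap-factors i≤a j≤b)) ⟩
  ∑≤ a (λ i → ∑≤ b (λ j → g i j * f (a ∸ i) (b ∸ j)))
    ∎
  where
  open ≡-Reasoning
  swap-factors : ∀ {i j} → i ≤ a → j ≤ b →
                 f (a ∸ i) (b ∸ j) * g (a ∸ (a ∸ i)) (b ∸ (b ∸ j)) ≡ g i j * f (a ∸ i) (b ∸ j)
  swap-factors {i} {j} i≤a j≤b =
    trans (cong₂ (λ u v → f (a ∸ i) (b ∸ j) * g u v) (ℕP.m∸[m∸n]≡n i≤a) (ℕP.m∸[m∸n]≡n j≤b))
          (ℚP.*-comm (f (a ∸ i) (b ∸ j)) (g i j))

⊛-distribˡ-⊕ : ∀ h f g → h ⊛ (f ⊕ g) ≈ h ⊛ f ⊕ h ⊛ g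
⊛-distribˡ-⊕ h f g a b =
  trans (∑-cong (upTo (suc a)) (λ i →
           trans (∑-cong (upTo (suc b)) (λ j → ℚP.*-distribˡ-+ (h i j) (f (a ∸ i) (b ∸ j)) (g (a ∸ i) (b ∸ j))))
                 (∑-distrib-+ (hf i) (hg i) (upTo (suc b)))))
        (∑-distrib-+ (λ i → ∑≤ b (hf i)) (λ i → ∑≤ b (hg i)) (upTo (suc a)))
  where
  hf hg : ℕ → ℕ → ℚ
  hf i j = h i j * f (a ∸ i) (b ∸ j)
  hg i j = h i j * g (a ∸ i) (b ∸ j)

⊛-distribˡ-⊖ : ∀ h f g → h ⊛ (f ⊖ g) ≈ h ⊛ f ⊖ h ⊛ g
⊛-distribˡ-⊖ h f g a b =
  trans (∑-cong (upTo (suc a)) (λ i →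
           trans (∑-cong (upTo (suc b)) (λ j → *-distribˡ-- (h i j) (f (a ∸ i) (b ∸ j)) (g (a ∸ i) (b ∸ j))))
                 (∑-distrib-- (hf i) (hg i) (upTo (suc b)))))
        (∑-distrib-- (λ i → ∑≤ b (hf i)) (λ i → ∑≤ b (hg i)) (upTo (suc a)))
  where
  hf hg : ℕ → ℕ → ℚ
  hf i j = h i j * f (a ∸ i) (b ∸ j)
  hg i j = h i j * g (a ∸ i) (b ∸ j)

⊛-·ʳ : ∀ h c f → h ⊛ (c · f) ≈ c · (h ⊛ f)
⊛-·ʳ h c f a b =
  trans (∑-cong (upTo (suc a)) (λ i →
           trans (∑-cong (upTo (suc b)) (λ j → x*[c*y]≡c*[x*y] (h i j) c (f (a ∸ i) (b ∸ j))))
                 (sym (∑-*ˡ c (hf i) (upTo (suc b))))))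
        (sym (∑-*ˡ c (λ i → ∑≤ b (hf i)) (upTo (suc a))))
  where
  hf : ℕ → ℕ → ℚ
  hf i j = h i j * f (a ∸ i) (b ∸ j)
  x*[c*y]≡c*[x*y] : ∀ x c y → x * (c * y) ≡ c * (x * y)
  x*[c*y]≡c*[x*y] = solve 3 (λ x c y → x :* (c :* y) := c :* (x :* y)) refl

⊛-zeroʳ : ∀ h → h ⊛ 0ₛ ≈ 0ₛ
⊛-zeroʳ h a b = ∑-zero (upTo (suc a)) (λ {i} _ → ∑-zero (upTo (suc b)) (λ {j} _ → ℚP.*-zeroʳ (h i j)))

⊛-distribʳ-⊕ : ∀ f g h → (f ⊕ g) ⊛ h ≈ f ⊛ h ⊕ g ⊛ h
⊛-distribʳ-⊕ f g h a b =
  trans (⊛-comm (f ⊕ g) h a b)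
        (trans (⊛-distribˡ-⊕ h f g a b) (cong₂ ℚ._+_ (⊛-comm h f a b) (⊛-comm h g a b)))

⊛-distribʳ-⊖ : ∀ f g h → (f ⊖ g) ⊛ h ≈ f ⊛ h ⊖ g ⊛ h
⊛-distribʳ-⊖ f g h a b =
  trans (⊛-comm (f ⊖ g) h a b)
        (trans (⊛-distribˡ-⊖ h f g a b) (cong₂ ℚ._-_ (⊛-comm h f a b) (⊛-comm h g a b)))

⊖-cong : ∀ {f f′ g g′} → f ≈ f′ → g ≈ g′ → f ⊖ g ≈ f′ ⊖ g′
⊖-cong f≈f′ g≈g′ a b = cong₂ ℚ._-_ (f≈f′ a b) (g≈g′ a b)

Σₛ-map-apply : ∀ (g : A → Series) xs a b → Σₛ (map g xs) a b ≡ ∑ (λ x → g x a b) xs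
Σₛ-map-apply g [] a b = refl
Σₛ-map-apply g (x ∷ xs) a b = cong (g x a b ℚ.+_) (Σₛ-map-apply g xs a b)

Σₛ-map-cong : ∀ {g h : A → Series} xs → (∀ x → g x ≈ h x) → Σₛ (map g xs) ≈ Σₛ (map h xs)
Σₛ-map-cong {g = g} {h} xs g≈h a b =
  trans (Σₛ-map-apply g xs a b) (trans (∑-cong xs (λ x → g≈h x a b)) (sym (Σₛ-map-apply h xs a b)))

Σₛ-map-⊖ : ∀ (g h : A → Series) xs → Σₛ (map (λ x → g x ⊖ h x) xs) ≈ Σₛ (map g xs) ⊖ Σₛ (map h xs)
Σₛ-map-⊖ g h xs a b =
  trans (Σₛ-map-apply (λ x → g x ⊖ h x) xs a b)
  (trans (∑-distrib-- (λ x → g x a b) (λ x → h x a b) xs)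
         (sym (cong₂ ℚ._-_ (Σₛ-map-apply g xs a b) (Σₛ-map-apply h xs a b))))

⊛-Σₛ : ∀ h (g : A → Series) xs → h ⊛ Σₛ (map g xs) ≈ Σₛ (map (λ x → h ⊛ g x) xs)
⊛-Σₛ h g [] = ⊛-zeroʳ h
⊛-Σₛ h g (x ∷ xs) a b =
  trans (⊛-distribˡ-⊕ h (g x) (Σₛ (map g xs)) a b) (cong ((h ⊛ g x) a b ℚ.+_) (⊛-Σₛ h g xs a b))

⊛-Σₛ-apply : ∀ h (g : A → Series) xs a b → (h ⊛ Σₛ (map g xs)) a b ≡ ∑ (λ x → (h ⊛ g x) a b) xs
⊛-Σₛ-apply h g xs a b = trans (⊛-Σₛ h g xs a b) (Σₛ-map-apply (λ x → h ⊛ g x) xs a b)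

⊛-Σₛ-·-apply : ∀ h (c : A → ℚ) (g : A → Series) xs a b →
               (h ⊛ Σₛ (map (λ x → c x · g x) xs)) a b ≡ ∑ (λ x → c x * (h ⊛ g x) a b) xs
⊛-Σₛ-·-apply h c g xs a b =
  trans (⊛-Σₛ-apply h (λ x → c x · g x) xs a b) (∑-cong xs (λ x → ⊛-·ʳ h (c x) (g x) a b))

-- Multiplication by q^I t^J (see mono-⊛); the guards undo the truncation in a ∸ I and b ∸ J.
shift : ℕ → ℕ → Series → Series
shift I J f a b = guard≤ I a (guard≤ J b (f (a ∸ I) (b ∸ J)))

shift-cong : ∀ I J {f g} → f ≈ g → shift I J f ≈ shift I J g
shift-cong I J f≈g a b = cong (guard≤ I a ∘ guard≤ J b) (f≈g (a ∸ I) (b ∸ J))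

mono-⊛ : ∀ I J f → mono I J ⊛ f ≈ shift I J f
mono-⊛ I J f a b = begin
  ∑≤ a (λ i → ∑≤ b (λ j → 𝟙 (does (i ≟ I) ∧ does (j ≟ J)) * f (a ∸ i) (b ∸ j)))
    ≡⟨ ∑-cong (upTo (suc a)) (λ i → trans (∑-cong (upTo (suc b)) (split-𝟙 i))
                                          (sym (∑-*ˡ (𝟙 (does (i ≟ I))) (δf i) (upTo (suc b))))) ⟩
  ∑≤ a (λ i → 𝟙 (does (i ≟ I)) * ∑≤ b (λ j → 𝟙 (does (j ≟ J)) * f (a ∸ i) (b ∸ j)))
    ≡⟨ ∑-cong (upTo (suc a)) (λ i → cong (𝟙 (does (i ≟ I)) *_) (∑≤-δ b J (λ j → f (a ∸ i) (b ∸ j)))) ⟩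
  ∑≤ a (λ i → 𝟙 (does (i ≟ I)) * guard≤ J b (f (a ∸ i) (b ∸ J)))
    ≡⟨ ∑≤-δ a I (λ i → guard≤ J b (f (a ∸ i) (b ∸ J))) ⟩
  shift I J f a b
    ∎
  where
  open ≡-Reasoning
  split-𝟙 : ∀ i j → 𝟙 (does (i ≟ I) ∧ does (j ≟ J)) * f (a ∸ i) (b ∸ j)
                  ≡ 𝟙 (does (i ≟ I)) * (𝟙 (does (j ≟ J)) * f (a ∸ i) (b ∸ j))
  split-𝟙 i j = trans (cong (_* f (a ∸ i) (b ∸ j)) (𝟙-∧ (does (i ≟ I)) (does (j ≟ J))))
                      (ℚP.*-assoc (𝟙 (does (i ≟ I))) (𝟙 (does (j ≟ J))) (f (a ∸ i) (b ∸ j)))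
  δf : ℕ → ℕ → ℚ
  δf i j = 𝟙 (does (j ≟ J)) * f (a ∸ i) (b ∸ j)

⊛-identityˡ : ∀ f → 1ₛ ⊛ f ≈ f
⊛-identityˡ f a b = trans (mono-⊛ 0 0 f a b) (trans (guard≤-yes {0} {a} _ z≤n) (guard≤-yes {0} {b} _ z≤n))

⊛-identityʳ : ∀ f → f ⊛ 1ₛ ≈ f
⊛-identityʳ f a b = trans (⊛-comm f 1ₛ a b) (⊛-identityˡ f a b)

⊛-shift : ∀ I J g h → g ⊛ shift I J h ≈ shift I J (g ⊛ h)
⊛-shift I J g h a b = begin
  ∑≤ a (λ i → ∑≤ b (λ j → g i j * guard≤ I (a ∸ i) (guard≤ J (b ∸ j) (h (a ∸ i ∸ I) (b ∸ j ∸ J)))))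
    ≡⟨ ∑-cong (upTo (suc a)) (λ i → trans (∑-cong (upTo (suc b)) (move-guards i))
                                          (∑-guard≤ I (a ∸ i) (λ j → guard≤ J (b ∸ j) (H i j)) (upTo (suc b)))) ⟩
  ∑≤ a (λ i → guard≤ I (a ∸ i) (∑≤ b (λ j → guard≤ J (b ∸ j) (H i j))))
    ≡⟨ ∑-cong (upTo (suc a)) (λ i → cong (guard≤ I (a ∸ i)) (∑≤-guard≤-∸ J b (H i))) ⟩
  ∑≤ a (λ i → guard≤ I (a ∸ i) (guard≤ J b (∑≤ (b ∸ J) (H i))))
    ≡⟨ ∑≤-guard≤-∸ I a (λ i → guard≤ J b (∑≤ (b ∸ J) (H i))) ⟩
  guard≤ I a (∑≤ (a ∸ I) (λ i → guard≤ J b (∑≤ (b ∸ J) (H i))))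
    ≡⟨ cong (guard≤ I a) (∑-guard≤ J b (λ i → ∑≤ (b ∸ J) (H i)) (upTo (suc (a ∸ I)))) ⟩
  shift I J (g ⊛ h) a b
    ∎
  where
  open ≡-Reasoning
  H : ℕ → ℕ → ℚ
  H i j = g i j * h (a ∸ I ∸ i) (b ∸ J ∸ j)
  move-guards : ∀ i j → g i j * guard≤ I (a ∸ i) (guard≤ J (b ∸ j) (h (a ∸ i ∸ I) (b ∸ j ∸ J)))
                      ≡ guard≤ I (a ∸ i) (guard≤ J (b ∸ j) (H i j))
  move-guards i j =
    trans (*-guard≤ I (a ∸ i) (g i j) _) (cong (guard≤ I (a ∸ i))
      (trans (*-guard≤ J (b ∸ j) (g i j) _) (cong₂ (λ u v → guard≤ J (b ∸ j) (g i j * h u v))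
                                             (∸-∸-comm a i I) (∸-∸-comm b j J))))

shift-shift : ∀ I J K L f → shift I J (shift K L f) ≈ shift (I ℕ.+ K) (J ℕ.+ L) f
shift-shift I J K L f a b = begin
  guard≤ I a (guard≤ J b (guard≤ K (a ∸ I) (guard≤ L (b ∸ J) (f (a ∸ I ∸ K) (b ∸ J ∸ L)))))
    ≡⟨ cong (guard≤ I a) (guard≤-comm J b K (a ∸ I) _) ⟩
  guard≤ I a (guard≤ K (a ∸ I) (guard≤ J b (guard≤ L (b ∸ J) (f (a ∸ I ∸ K) (b ∸ J ∸ L)))))
    ≡⟨ guard≤-guard≤ I K a _ ⟩
  guard≤ (I ℕ.+ K) a (guard≤ J b (guard≤ L (b ∸ J) (f (a ∸ I ∸ K) (b ∸ J ∸ L))))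
    ≡⟨ cong (guard≤ (I ℕ.+ K) a) (guard≤-guard≤ J L b _) ⟩
  guard≤ (I ℕ.+ K) a (guard≤ (J ℕ.+ L) b (f (a ∸ I ∸ K) (b ∸ J ∸ L)))
    ≡⟨ cong₂ (λ u v → guard≤ (I ℕ.+ K) a (guard≤ (J ℕ.+ L) b (f u v))) (ℕP.∸-+-assoc a I K) (ℕP.∸-+-assoc b J L) ⟩
  shift (I ℕ.+ K) (J ℕ.+ L) f a b
    ∎
  where open ≡-Reasoning

mono-⊛-mono : ∀ I J K L f → mono I J ⊛ (mono K L ⊛ f) ≈ mono (I ℕ.+ K) (J ℕ.+ L) ⊛ f
mono-⊛-mono I J K L f = begin
  mono I J ⊛ (mono K L ⊛ f)         ≈⟨ mono-⊛ I J _ ⟩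
  shift I J (mono K L ⊛ f)          ≈⟨ shift-cong I J (mono-⊛ K L f) ⟩
  shift I J (shift K L f)           ≈⟨ shift-shift I J K L f ⟩
  shift (I ℕ.+ K) (J ℕ.+ L) f       ≈⟨ mono-⊛ (I ℕ.+ K) (J ℕ.+ L) f ⟨
  mono (I ℕ.+ K) (J ℕ.+ L) ⊛ f      ∎
  where open ≈-Reasoning

mono-⊛-⊛ : ∀ I J g h → mono I J ⊛ (g ⊛ h) ≈ g ⊛ (mono I J ⊛ h)
mono-⊛-⊛ I J g h = begin
  mono I J ⊛ (g ⊛ h)   ≈⟨ mono-⊛ I J (g ⊛ h) ⟩
  shift I J (g ⊛ h)    ≈⟨ ⊛-shift I J g h ⟨
  g ⊛ shift I J h      ≈⟨ ⊛-congʳ g (mono-⊛ I J h) ⟨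
  g ⊛ (mono I J ⊛ h)   ∎
  where open ≈-Reasoning

mono-⊛-assoc : ∀ I J g h → (mono I J ⊛ g) ⊛ h ≈ mono I J ⊛ (g ⊛ h)
mono-⊛-assoc I J g h = begin
  (mono I J ⊛ g) ⊛ h   ≈⟨ ⊛-comm (mono I J ⊛ g) h ⟩
  h ⊛ (mono I J ⊛ g)   ≈⟨ mono-⊛-⊛ I J h g ⟨
  mono I J ⊛ (h ⊛ g)   ≈⟨ ⊛-congʳ (mono I J) (⊛-comm h g) ⟩
  mono I J ⊛ (g ⊛ h)   ∎
  where open ≈-Reasoning

-- The images pA and pB of the power sums

𝟙-∣-unfold : ∀ k a → 𝟙 (does (suc k ∣? a))
                     ≡ 𝟙 (does (a ≟ 0)) ℚ.+ guard≤ (suc k) a (𝟙 (does (suc k ∣? (a ∸ suc k))))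
𝟙-∣-unfold k zero = begin
  𝟙 (does (suc k ∣? 0))                                ≡⟨ cong 𝟙 (dec-true (suc k ∣? 0) (suc k ∣0)) ⟩
  1ℚ                                                   ≡⟨ ℚP.+-identityʳ 1ℚ ⟨
  1ℚ ℚ.+ 0ℚ                                            ≡⟨ cong (1ℚ ℚ.+_) (guard≤-no {suc k} {0} (𝟙 (does (suc k ∣? 0))) λ ()) ⟨
  1ℚ ℚ.+ guard≤ (suc k) 0 (𝟙 (does (suc k ∣? 0)))     ∎
  where open ≡-Reasoning
𝟙-∣-unfold k (suc a) = trans (by-cases (suc k ≤? suc a)) (sym (ℚP.+-identityˡ _))
  where
  by-cases : Dec (suc k ≤ suc a) →
             𝟙 (does (suc k ∣? suc a)) ≡ guard≤ (suc k) (suc a) (𝟙 (does (suc k ∣? (suc a ∸ suc k))))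
  by-cases (yes k≤a) = trans (𝟙-does-⇔ (suc k ∣? suc a) (suc k ∣? (suc a ∸ suc k)) to from) (sym (guard≤-yes _ k≤a))
    where
    to : suc k ∣ suc a → suc k ∣ suc a ∸ suc k
    to d = ∣m+n∣m⇒∣n (subst (suc k ∣_) (sym (ℕP.m+[n∸m]≡n k≤a)) d) ∣-refl
    from : suc k ∣ suc a ∸ suc k → suc k ∣ suc a
    from d = ∣m∸n∣n⇒∣m (suc k) k≤a d ∣-refl
  by-cases (no k≰a) = trans (cong 𝟙 (dec-false (suc k ∣? suc a) (k≰a ∘ ∣⇒≤))) (sym (guard≤-no _ k≰a))

geom-unfold : ∀ k → geom (suc k) ≈ 1ₛ ⊕ mono (suc k) 0 ⊛ geom (suc k)
geom-unfold k a b = begin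
  𝟙 (does (K ∣? a) ∧ b≡0)
    ≡⟨ 𝟙-∧ (does (K ∣? a)) b≡0 ⟩
  𝟙 (does (K ∣? a)) * 𝟙 b≡0
    ≡⟨ cong (_* 𝟙 b≡0) (𝟙-∣-unfold k a) ⟩
  (𝟙 (does (a ≟ 0)) ℚ.+ guard≤ K a (𝟙 (does (K ∣? (a ∸ K))))) * 𝟙 b≡0
    ≡⟨ ℚP.*-distribʳ-+ (𝟙 b≡0) (𝟙 (does (a ≟ 0))) _ ⟩
  𝟙 (does (a ≟ 0)) * 𝟙 b≡0 ℚ.+ guard≤ K a (𝟙 (does (K ∣? (a ∸ K)))) * 𝟙 b≡0
    ≡⟨ cong₂ ℚ._+_ (sym (𝟙-∧ (does (a ≟ 0)) b≡0))
                   (trans (guard≤-* K a _ (𝟙 b≡0)) (cong (guard≤ K a) (sym (𝟙-∧ (does (K ∣? (a ∸ K))) b≡0)))) ⟩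
  1ₛ a b ℚ.+ guard≤ K a (geom K (a ∸ K) b)
    ≡⟨ cong (λ x → 1ₛ a b ℚ.+ guard≤ K a x) (guard≤-yes {0} {b} _ z≤n) ⟨
  1ₛ a b ℚ.+ shift K 0 (geom K) a b
    ≡⟨ cong (1ₛ a b ℚ.+_) (mono-⊛ K 0 (geom K) a b) ⟨
  (1ₛ ⊕ mono K 0 ⊛ geom K) a b
    ∎
  where
  open ≡-Reasoning
  K : ℕ
  K = suc k
  b≡0 : Bool
  b≡0 = does (b ≟ 0)

pA≈ : ∀ k → pA k ≈ geom k ⊖ mono 0 k ⊛ geom k
pA≈ k a b = trans (⊛-distribʳ-⊖ 1ₛ (mono 0 k) (geom k) a b)
                  (cong (ℚ._- (mono 0 k ⊛ geom k) a b) (⊛-identityˡ (geom k) a b))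

pA≈1ₛ⊕pB : ∀ k → pA (suc k) ≈ 1ₛ ⊕ pB (suc k)
pA≈1ₛ⊕pB k a b = begin
  pA K a b                                      ≡⟨ pA≈ K a b ⟩
  G a b ℚ.- (T ⊛ G) a b                         ≡⟨ cong (ℚ._- (T ⊛ G) a b) (geom-unfold k a b) ⟩
  (1ₛ a b ℚ.+ (Q ⊛ G) a b) ℚ.- (T ⊛ G) a b      ≡⟨ [x+y]-z≡x+[y-z] (1ₛ a b) ((Q ⊛ G) a b) ((T ⊛ G) a b) ⟩
  1ₛ a b ℚ.+ ((Q ⊛ G) a b ℚ.- (T ⊛ G) a b)      ≡⟨ cong (1ₛ a b ℚ.+_) (⊛-distribʳ-⊖ Q T G a b) ⟨
  (1ₛ ⊕ pB K) a b                               ∎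
  where
  open ≡-Reasoning
  K : ℕ
  K = suc k
  G T Q : Series
  G = geom K
  T = mono 0 K
  Q = mono K 0
  [x+y]-z≡x+[y-z] : ∀ x y z → (x ℚ.+ y) ℚ.- z ≡ x ℚ.+ (y ℚ.- z)
  [x+y]-z≡x+[y-z] = solve 3 (λ x y z → (x :+ y) :- z := x :+ (y :- z)) refl

mono⊕pB≈mono⊛pA : ∀ k → mono 0 (suc k) ⊕ pB (suc k) ≈ mono (suc k) 0 ⊛ pA (suc k)
mono⊕pB≈mono⊛pA k a b = begin
  T a b ℚ.+ pB K a b                                       ≡⟨ cong (T a b ℚ.+_) (⊛-distribʳ-⊖ Q T G a b) ⟩
  T a b ℚ.+ ((Q ⊛ G) a b ℚ.- (T ⊛ G) a b)                  ≡⟨ cong (λ x → T a b ℚ.+ ((Q ⊛ G) a b ℚ.- x)) T⊛G ⟩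
  T a b ℚ.+ ((Q ⊛ G) a b ℚ.- (T a b ℚ.+ (M ⊛ G) a b))      ≡⟨ t+[q-[t+m]]≡q-m (T a b) ((Q ⊛ G) a b) ((M ⊛ G) a b) ⟩
  (Q ⊛ G) a b ℚ.- (M ⊛ G) a b                              ≡⟨ cong (λ x → (Q ⊛ G) a b ℚ.- x) Q⊛T⊛G ⟨
  (Q ⊛ G) a b ℚ.- (Q ⊛ (T ⊛ G)) a b                        ≡⟨ ⊛-distribˡ-⊖ Q G (T ⊛ G) a b ⟨
  (Q ⊛ (G ⊖ T ⊛ G)) a b                                    ≡⟨ ⊛-congʳ Q (pA≈ K) a b ⟨
  (Q ⊛ pA K) a b                                           ∎
  where
  open ≡-Reasoning
  K : ℕ
  K = suc k
  G T Q M : Series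
  G = geom K
  T = mono 0 K
  Q = mono K 0
  M = mono K K
  Q⊛T⊛G : (Q ⊛ (T ⊛ G)) a b ≡ (M ⊛ G) a b
  Q⊛T⊛G = trans (mono-⊛-mono K 0 0 K G a b) (cong (λ u → (mono u K ⊛ G) a b) (ℕP.+-identityʳ K))
  T⊛G : (T ⊛ G) a b ≡ T a b ℚ.+ (M ⊛ G) a b
  T⊛G = begin
    (T ⊛ G) a b                           ≡⟨ ⊛-congʳ T (geom-unfold k) a b ⟩
    (T ⊛ (1ₛ ⊕ Q ⊛ G)) a b                ≡⟨ ⊛-distribˡ-⊕ T 1ₛ (Q ⊛ G) a b ⟩
    (T ⊛ 1ₛ) a b ℚ.+ (T ⊛ (Q ⊛ G)) a b    ≡⟨ cong₂ ℚ._+_ (⊛-identityʳ T a b) (mono-⊛-mono 0 K K 0 G a b) ⟩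
    T a b ℚ.+ (mono K (K ℕ.+ 0) ⊛ G) a b  ≡⟨ cong (λ u → T a b ℚ.+ (mono K u ⊛ G) a b) (ℕP.+-identityʳ K) ⟩
    T a b ℚ.+ (M ⊛ G) a b                 ∎
  t+[q-[t+m]]≡q-m : ∀ t q m → t ℚ.+ (q ℚ.- (t ℚ.+ m)) ≡ q ℚ.- m
  t+[q-[t+m]]≡q-m = solve 3 (λ t q m → t :+ (q :- (t :+ m)) := q :- m) refl

Πₛ-map-cong : ∀ {P : ℕ → Set} (f g : ℕ → Series) {xs} → All P xs → (∀ {k} → P k → f k ≈ g k) →
              Πₛ (map f xs) ≈ Πₛ (map g xs)
Πₛ-map-cong f g All.[] _ = ≈-refl {1ₛ}
Πₛ-map-cong f g (px ∷ pxs) f≈g = ⊛-cong (f≈g px) (Πₛ-map-cong f g pxs f≈g)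

Πₛ-mono-⊛ : ∀ (g : ℕ → Series) xs → Πₛ (map (λ k → mono k 0 ⊛ g k) xs) ≈ mono (size xs) 0 ⊛ Πₛ (map g xs)
Πₛ-mono-⊛ g [] = ≈-sym (⊛-identityˡ 1ₛ)
Πₛ-mono-⊛ g (l ∷ xs) = begin
  (mono l 0 ⊛ g l) ⊛ Πₛ (map (λ k → mono k 0 ⊛ g k) xs)  ≈⟨ ⊛-congʳ (mono l 0 ⊛ g l) (Πₛ-mono-⊛ g xs) ⟩
  (mono l 0 ⊛ g l) ⊛ (mono s 0 ⊛ Π)                      ≈⟨ mono-⊛-assoc l 0 (g l) (mono s 0 ⊛ Π) ⟩
  mono l 0 ⊛ (g l ⊛ (mono s 0 ⊛ Π))                      ≈⟨ ⊛-congʳ (mono l 0) (mono-⊛-⊛ s 0 (g l) Π) ⟨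
  mono l 0 ⊛ (mono s 0 ⊛ (g l ⊛ Π))                      ≈⟨ mono-⊛-mono l 0 s 0 (g l ⊛ Π) ⟩
  mono (l ℕ.+ s) 0 ⊛ (g l ⊛ Π)                           ∎
  where
  open ≈-Reasoning
  s : ℕ
  s = size xs
  Π : Series
  Π = Πₛ (map g xs)

-- One pair (sum of S , λ′ without S) for each set S of positions in λ′.
splits : List ℕ → List (ℕ × List ℕ)
splits [] = (0 , []) ∷ []
splits (l ∷ xs) = map (map₁ (ℕ._+ l)) (splits xs) ++ map (map₂ (l ∷_)) (splits xs)

Πₛ-⊕-splits : ∀ (e : ℕ → ℕ) → e 0 ≡ 0 → (∀ m n → e (m ℕ.+ n) ≡ e m ℕ.+ e n) → ∀ (g : ℕ → Series) xs →
              Πₛ (map (λ k → mono 0 (e k) ⊕ g k) xs)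
                ≈ Σₛ (map (λ p → mono 0 (e (proj₁ p)) ⊛ Πₛ (map g (proj₂ p))) (splits xs))
Πₛ-⊕-splits e e-0 e-+ g [] a b = begin
  1ₛ a b                          ≡⟨ ⊛-identityˡ 1ₛ a b ⟨
  (1ₛ ⊛ 1ₛ) a b                   ≡⟨ cong (λ u → (mono 0 u ⊛ 1ₛ) a b) e-0 ⟨
  (mono 0 (e 0) ⊛ 1ₛ) a b         ≡⟨ ℚP.+-identityʳ _ ⟨
  (mono 0 (e 0) ⊛ 1ₛ) a b ℚ.+ 0ℚ  ∎
  where open ≡-Reasoning
Πₛ-⊕-splits e e-0 e-+ g (l ∷ xs) a b = begin
  ((mono 0 (e l) ⊕ g l) ⊛ Πₛ (map (λ k → mono 0 (e k) ⊕ g k) xs)) a b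
    ≡⟨ ⊛-congʳ (mono 0 (e l) ⊕ g l) (Πₛ-⊕-splits e e-0 e-+ g xs) a b ⟩
  ((mono 0 (e l) ⊕ g l) ⊛ Σₛ (map F (splits xs))) a b
    ≡⟨ ⊛-distribʳ-⊕ (mono 0 (e l)) (g l) (Σₛ (map F (splits xs))) a b ⟩
  (mono 0 (e l) ⊛ Σₛ (map F (splits xs))) a b ℚ.+ (g l ⊛ Σₛ (map F (splits xs))) a b
    ≡⟨ cong₂ ℚ._+_ (⊛-Σₛ-apply (mono 0 (e l)) F (splits xs) a b) (⊛-Σₛ-apply (g l) F (splits xs) a b) ⟩
  ∑ (λ p → (mono 0 (e l) ⊛ F p) a b) (splits xs) ℚ.+ ∑ (λ p → (g l ⊛ F p) a b) (splits xs)
    ≡⟨ cong₂ ℚ._+_ (∑-cong (splits xs) take-l) (∑-cong (splits xs) leave-l) ⟩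
  ∑ (λ p → F (map₁ (ℕ._+ l) p) a b) (splits xs) ℚ.+ ∑ (λ p → F (map₂ (l ∷_) p) a b) (splits xs)
    ≡⟨ cong₂ ℚ._+_ (∑-map (λ p → F p a b) (map₁ (ℕ._+ l)) (splits xs)) (∑-map (λ p → F p a b) (map₂ (l ∷_)) (splits xs)) ⟨
  ∑ (λ p → F p a b) (map (map₁ (ℕ._+ l)) (splits xs)) ℚ.+ ∑ (λ p → F p a b) (map (map₂ (l ∷_)) (splits xs))
    ≡⟨ ∑-++ (λ p → F p a b) (map (map₁ (ℕ._+ l)) (splits xs)) _ ⟨
  ∑ (λ p → F p a b) (splits (l ∷ xs))
    ≡⟨ Σₛ-map-apply F (splits (l ∷ xs)) a b ⟨
  Σₛ (map F (splits (l ∷ xs))) a b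
    ∎
  where
  open ≡-Reasoning
  F : ℕ × List ℕ → Series
  F p = mono 0 (e (proj₁ p)) ⊛ Πₛ (map g (proj₂ p))
  take-l : ∀ p → (mono 0 (e l) ⊛ F p) a b ≡ F (map₁ (ℕ._+ l) p) a b
  take-l (s , r) = trans (mono-⊛-mono 0 (e l) 0 (e s) (Πₛ (map g r)) a b)
    (cong (λ u → (mono 0 u ⊛ Πₛ (map g r)) a b) (trans (ℕP.+-comm (e l) (e s)) (sym (e-+ s l))))
  leave-l : ∀ p → (g l ⊛ F p) a b ≡ F (map₂ (l ∷_) p) a b
  leave-l (s , r) = sym (mono-⊛-⊛ 0 (e s) (g l) (Πₛ (map g r)) a b)

Σₛ-splits-pB : ∀ λ′ → All (1 ≤_) λ′ →
  Σₛ (map (λ p → (1ₛ ⊖ mono 0 (proj₁ p)) ⊛ Πₛ (map pB (proj₂ p))) (splits λ′))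
    ≈ (1ₛ ⊖ mono (size λ′) 0) ⊛ Πₛ (map pA λ′)
Σₛ-splits-pB λ′ pos = begin
  Σₛ (map (λ p → (1ₛ ⊖ mono 0 (proj₁ p)) ⊛ Π (proj₂ p)) (splits λ′))
    ≈⟨ Σₛ-map-cong (splits λ′) (λ p → ⊛-distribʳ-⊖ 1ₛ (mono 0 (proj₁ p)) (Π (proj₂ p))) ⟩
  Σₛ (map (λ p → 1ₛ ⊛ Π (proj₂ p) ⊖ mono 0 (proj₁ p) ⊛ Π (proj₂ p)) (splits λ′))
    ≈⟨ Σₛ-map-⊖ (λ p → 1ₛ ⊛ Π (proj₂ p)) (λ p → mono 0 (proj₁ p) ⊛ Π (proj₂ p)) (splits λ′) ⟩
  Σₛ (map (λ p → 1ₛ ⊛ Π (proj₂ p)) (splits λ′)) ⊖ Σₛ (map (λ p → mono 0 (proj₁ p) ⊛ Π (proj₂ p)) (splits λ′))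
    ≈⟨ ⊖-cong (Πₛ-⊕-splits (λ _ → 0) refl (λ _ _ → refl) pB λ′) (Πₛ-⊕-splits (λ k → k) refl (λ _ _ → refl) pB λ′) ⟨
  Πₛ (map (λ k → 1ₛ ⊕ pB k) λ′) ⊖ Πₛ (map (λ k → mono 0 k ⊕ pB k) λ′)
    ≈⟨ ⊖-cong (Πₛ-map-cong (λ k → 1ₛ ⊕ pB k) pA pos λ { {suc k} _ → ≈-sym (pA≈1ₛ⊕pB k) })
              (Πₛ-map-cong (λ k → mono 0 k ⊕ pB k) (λ k → mono k 0 ⊛ pA k) pos λ { {suc k} _ → mono⊕pB≈mono⊛pA k }) ⟩
  Πₛ (map pA λ′) ⊖ Πₛ (map (λ k → mono k 0 ⊛ pA k) λ′)
    ≈⟨ ⊖-cong (≈-sym (⊛-identityˡ (Πₛ (map pA λ′)))) (Πₛ-mono-⊛ pA λ′) ⟩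
  1ₛ ⊛ Πₛ (map pA λ′) ⊖ mono (size λ′) 0 ⊛ Πₛ (map pA λ′)
    ≈⟨ ⊛-distribʳ-⊖ 1ₛ (mono (size λ′) 0) (Πₛ (map pA λ′)) ⟨
  (1ₛ ⊖ mono (size λ′) 0) ⊛ Πₛ (map pA λ′)
    ∎
  where
  open ≈-Reasoning
  Π : List ℕ → Series
  Π r = Πₛ (map pB r)

-- Partitions

Decreasing : List ℕ → Set
Decreasing = Linked ℕ._≥_

≥-trans : ∀ {x y z} → x ℕ.≥ y → y ℕ.≥ z → x ℕ.≥ z
≥-trans x≥y y≥z = ℕP.≤-trans y≥z x≥y

Decreasing-∷ : ∀ {x xs} → All (_≤ x) xs → Decreasing xs → Decreasing (x ∷ xs)
Decreasing-∷ [] _ = [-]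
Decreasing-∷ (y≤x ∷ _) d = y≤x ∷ d

Decreasing⇒All≤ : ∀ {x xs} → Decreasing (x ∷ xs) → All (_≤ x) xs
Decreasing⇒All≤ d = All.tail (Linked⇒All ≥-trans ℕP.≤-refl d)

Decreasing-resp-⊆ : ∀ {xs ys} → xs ⊆ ys → Decreasing ys → Decreasing xs
Decreasing-resp-⊆ xs⊆ys d = AllPairs⇒Linked (AllPairs-resp-⊆ xs⊆ys (Linked⇒AllPairs ≥-trans d))

Decreasing-↭ : ∀ {xs ys} → Decreasing xs → Decreasing ys → xs ↭ ys → xs ≡ ys
Decreasing-↭ dxs dys xs↭ys = ≋⇒≡ (↗↭↗⇒≋ (DecTotalOrder.totalOrder ≥-decTotalOrder) dxs dys (↭⇒↭ₛ xs↭ys))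

IsPartition-resp-⊆ : ∀ {xs ys} → xs ⊆ ys → IsPartition ys → IsPartition xs
IsPartition-resp-⊆ xs⊆ys (pos , dec) = All-resp-⊆ xs⊆ys pos , Decreasing-resp-⊆ xs⊆ys dec

∈⇒≤size : ∀ {z} xs → z ∈ xs → z ≤ size xs
∈⇒≤size (x ∷ xs) (here refl) = ℕP.m≤m+n x (size xs)
∈⇒≤size (x ∷ xs) (there z∈xs) = ℕP.≤-trans (∈⇒≤size xs z∈xs) (ℕP.m≤n+m (size xs) x)

partitionsLE-sound : ∀ f n k {μ} → μ ∈ partitionsLE f n k → IsPartition μ × size μ ≡ n × All (_≤ k) μ
partitionsLE-sound zero zero k (here refl) = ([] , []) , refl , []
partitionsLE-sound (suc f) zero k (here refl) = ([] , []) , refl , []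
partitionsLE-sound (suc f) (suc n) k μ∈
  with j , j∈ , jν∈ ← find (∈-concatMap⁻ (λ j → map (j ∷_) (partitionsLE f (suc n ∸ j) j))
                                         {xs = map suc (upTo (k ⊓ suc n))} μ∈)
  with ν , ν∈ , refl ← ∈-map⁻ (j ∷_) jν∈
  with i , i∈ , refl ← ∈-map⁻ suc j∈
  with (ν-pos , ν-dec) , ν-size , ν≤j ← partitionsLE-sound f (suc n ∸ suc i) (suc i) ν∈ =
  (s≤s z≤n ∷ ν-pos , Decreasing-∷ ν≤j ν-dec) ,
  trans (cong (suc i ℕ.+_) ν-size) (ℕP.m+[n∸m]≡n j≤1+n) ,
  j≤k ∷ All.map (λ l≤j → ℕP.≤-trans l≤j j≤k) ν≤j
  where
  j≤k : suc i ≤ k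
  j≤k = ℕP.≤-trans (∈-upTo⁻ i∈) (ℕP.m⊓n≤m k (suc n))
  j≤1+n : suc i ≤ suc n
  j≤1+n = ℕP.≤-trans (∈-upTo⁻ i∈) (ℕP.m⊓n≤n k (suc n))

partitionsLE-complete : ∀ f n k {μ} → n ≤ f → IsPartition μ → size μ ≡ n → All (_≤ k) μ →
                        μ ∈ partitionsLE f n k
partitionsLE-complete zero zero k {[]} _ _ _ _ = here refl
partitionsLE-complete (suc f) zero k {[]} _ _ _ _ = here refl
partitionsLE-complete f n k {zero ∷ μ} _ (() ∷ _ , _) _ _
partitionsLE-complete f zero k {suc x ∷ μ} _ _ () _
partitionsLE-complete zero (suc n) k () _ _ _
partitionsLE-complete (suc f) (suc n) k {[]} _ _ () _
partitionsLE-complete (suc f) (suc n) k {suc x ∷ μ} (s≤s n≤f) (_ ∷ μ-pos , dec) x+μ≡1+n (x≤k ∷ _) =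
  ∈-concatMap⁺ (λ j → map (j ∷_) (partitionsLE f (suc n ∸ j) j)) (lose x∈ (∈-map⁺ (suc x ∷_) μ∈))
  where
  x≤n : x ≤ n
  x≤n = ℕ.s≤s⁻¹ (subst (suc x ≤_) x+μ≡1+n (ℕP.m≤m+n (suc x) (size μ)))
  x∈ : suc x ∈ map suc (upTo (k ⊓ suc n))
  x∈ = ∈-map⁺ suc (∈-upTo⁺ (ℕP.⊓-glb x≤k (s≤s x≤n)))
  μ∈ : μ ∈ partitionsLE f (n ∸ x) (suc x)
  μ∈ = partitionsLE-complete f (n ∸ x) (suc x) (ℕP.≤-trans (ℕP.m∸n≤m n x) n≤f) (μ-pos , Linked.tail dec)
         (ℕP.+-cancelˡ-≡ (suc x) (size μ) (n ∸ x) (trans x+μ≡1+n (cong suc (sym (ℕP.m+[n∸m]≡n x≤n)))))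
         (Decreasing⇒All≤ dec)

partitionsLE-unique : ∀ f n k → Unique (partitionsLE f n k)
partitionsLE-unique zero zero k = [] ∷ []
partitionsLE-unique zero (suc n) k = []
partitionsLE-unique (suc f) zero k = [] ∷ []
partitionsLE-unique (suc f) (suc n) k =
  Unique-concatMap⁺ (λ j → map (j ∷_) (partitionsLE f (suc n ∸ j) j))
    (Unique.map⁺ ℕP.suc-injective (Unique.upTo⁺ (k ⊓ suc n)))
    (λ j → Unique.map⁺ List.∷-injectiveʳ (partitionsLE-unique f (suc n ∸ j) j))
    same-head
  where
  same-head : ∀ {i j μ} → μ ∈ map (i ∷_) (partitionsLE f (suc n ∸ i) i) →
              μ ∈ map (j ∷_) (partitionsLE f (suc n ∸ j) j) → i ≡ j
  same-head μ∈ μ∈′ with _ , _ , refl ← ∈-map⁻ _ μ∈ with _ , _ , eq ← ∈-map⁻ _ μ∈′ = List.∷-injectiveˡ eq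

partitions-sound : ∀ {n μ} → μ ∈ partitions n → IsPartition μ × size μ ≡ n
partitions-sound {n} μ∈ = let μ-part , μ-size , _ = partitionsLE-sound n n n μ∈ in μ-part , μ-size

partitions-complete : ∀ {μ} → IsPartition μ → μ ∈ partitions (size μ)
partitions-complete {μ} μ-part =
  partitionsLE-complete (size μ) (size μ) (size μ) ℕP.≤-refl μ-part refl (All.tabulate (∈⇒≤size μ))

partitions-unique : ∀ n → Unique (partitions n)
partitions-unique n = partitionsLE-unique n n n

removeOne-head : ∀ i xs → removeOne i (i ∷ xs) ≡ xs
removeOne-head i xs rewrite dec-true (i ≟ i) refl = refl

removeOne-≢ : ∀ {i x} xs → i ≢ x → removeOne i (x ∷ xs) ≡ x ∷ removeOne i xs
removeOne-≢ {i} {x} xs i≢x rewrite dec-false (i ≟ x) i≢x = refl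

insert-≤ : ∀ {i x} xs → x ≤ i → insert i (x ∷ xs) ≡ i ∷ x ∷ xs
insert-≤ {i} {x} xs x≤i rewrite dec-true (x ≤? i) x≤i = refl

insert-≰ : ∀ {i x} xs → ¬ x ≤ i → insert i (x ∷ xs) ≡ x ∷ insert i xs
insert-≰ {i} {x} xs x≰i rewrite dec-false (x ≤? i) x≰i = refl

removeOne-insert : ∀ i ρ → removeOne i (insert i ρ) ≡ ρ
removeOne-insert i [] = removeOne-head i []
removeOne-insert i (x ∷ xs) with x ≤? i
... | yes x≤i = trans (cong (removeOne i) (insert-≤ xs x≤i)) (removeOne-head i (x ∷ xs))
... | no x≰i = begin
  removeOne i (insert i (x ∷ xs))   ≡⟨ cong (removeOne i) (insert-≰ xs x≰i) ⟩
  removeOne i (x ∷ insert i xs)     ≡⟨ removeOne-≢ (insert i xs) (λ { refl → x≰i ℕP.≤-refl }) ⟩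
  x ∷ removeOne i (insert i xs)     ≡⟨ cong (x ∷_) (removeOne-insert i xs) ⟩
  x ∷ xs                            ∎
  where open ≡-Reasoning

removeOne-↭ : ∀ {i ν} → i ∈ ν → ν ↭ i ∷ removeOne i ν
removeOne-↭ {i} {x ∷ xs} i∈ with i ≟ x | i∈
... | yes refl | _ = subst (λ ys → i ∷ xs ↭ i ∷ ys) (sym (removeOne-head i xs)) ↭-refl
... | no i≢x | here i≡x = ⊥-elim (i≢x i≡x)
... | no i≢x | there i∈xs = subst (λ ys → x ∷ xs ↭ i ∷ ys) (sym (removeOne-≢ xs i≢x))
                                  (↭-trans (prep x (removeOne-↭ i∈xs)) (swap x i ↭-refl))

All-removeOne : ∀ {P : ℕ → Set} i {ν} → All P ν → All P (removeOne i ν)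
All-removeOne i [] = []
All-removeOne {P} i {x ∷ xs} (px ∷ pxs) with i ≟ x
... | yes refl = subst (All P) (sym (removeOne-head i xs)) pxs
... | no i≢x = subst (All P) (sym (removeOne-≢ xs i≢x)) (px ∷ All-removeOne i pxs)

Decreasing-removeOne : ∀ i {ν} → Decreasing ν → Decreasing (removeOne i ν)
Decreasing-removeOne i [] = []
Decreasing-removeOne i {x ∷ xs} dec with i ≟ x
... | yes refl = subst Decreasing (sym (removeOne-head i xs)) (Linked.tail dec)
... | no i≢x = subst Decreasing (sym (removeOne-≢ xs i≢x))
                 (Decreasing-∷ (All-removeOne i (Decreasing⇒All≤ dec)) (Decreasing-removeOne i (Linked.tail dec)))

IsPartition-removeOne : ∀ i {ν} → IsPartition ν → IsPartition (removeOne i ν)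
IsPartition-removeOne i (pos , dec) = All-removeOne i pos , Decreasing-removeOne i dec

IsPartition-insert : ∀ {i ρ} → 1 ≤ i → IsPartition ρ → IsPartition (insert i ρ)
IsPartition-insert {i} {ρ} 1≤i (pos , dec) = All-resp-↭ (↭-sym (insert-↭ i ρ)) (1≤i ∷ pos) , insert-↗ i dec

insert-removeOne : ∀ {i ν} → IsPartition ν → i ∈ ν → insert i (removeOne i ν) ≡ ν
insert-removeOne {i} {ν} (_ , dec) i∈ν =
  Decreasing-↭ (insert-↗ i (Decreasing-removeOne i dec)) dec
               (↭-trans (insert-↭ i (removeOne i ν)) (↭-sym (removeOne-↭ i∈ν)))

size-insert : ∀ i ρ → size (insert i ρ) ≡ i ℕ.+ size ρ
size-insert i ρ = sum-↭ (insert-↭ i ρ)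

size-removeOne : ∀ {i ν} → i ∈ ν → i ℕ.+ size (removeOne i ν) ≡ size ν
size-removeOne i∈ν = sym (sum-↭ (removeOne-↭ i∈ν))

∈-insert : ∀ i ρ → i ∈ insert i ρ
∈-insert i ρ = ∈-resp-↭ (↭-sym (insert-↭ i ρ)) (here refl)

∈-splits⁻ : ∀ xs {s r} → (s , r) ∈ splits xs → r ⊆ xs × s ℕ.+ size r ≡ size xs
∈-splits⁻ [] (here refl) = [] , refl
∈-splits⁻ (l ∷ xs) p∈ with ∈-++⁻ (map (map₁ (ℕ._+ l)) (splits xs)) p∈
... | inj₁ p∈₁ with (s , r) , p∈xs , refl ← ∈-map⁻ (map₁ (ℕ._+ l)) p∈₁
                with r⊆xs , s+r≡xs ← ∈-splits⁻ xs p∈xs =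
  l ∷ʳ r⊆xs , trans (ℕ+.xy∙z≈y∙xz s l (size r)) (cong (l ℕ.+_) s+r≡xs)
... | inj₂ p∈₂ with (s , r) , p∈xs , refl ← ∈-map⁻ (map₂ (l ∷_)) p∈₂
                with r⊆xs , s+r≡xs ← ∈-splits⁻ xs p∈xs =
  refl ∷ r⊆xs ,
  trans (ℕ+.x∙yz≈y∙xz s l (size r)) (cong (l ℕ.+_) s+r≡xs)

-- (ν , i) ↦ (i , removeOne i ν) identifies these two lists, with inverse (i , ρ) ↦ (insert i ρ , i).
markedPartitions : ℕ → List (List ℕ × ℕ)
markedPartitions n = concatMap (λ ν → map (ν ,_) (distinctParts ν)) (partitions n)

insertedPartitions : ℕ → List (List ℕ × ℕ)
insertedPartitions n = concatMap (λ i → map (λ ρ → insert i ρ , i) (partitions (n ∸ i))) (map suc (upTo n))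

markedPartitions-unique : ∀ n → Unique (markedPartitions n)
markedPartitions-unique n =
  Unique-concatMap⁺ (λ ν → map (ν ,_) (distinctParts ν)) (partitions-unique n)
    (λ ν → Unique.map⁺ Product.,-injectiveʳ (deduplicate-! ν))
    (λ p∈ p∈′ → let _ , _ , p≡ = ∈-map⁻ _ p∈ ; _ , _ , p≡′ = ∈-map⁻ _ p∈′ in
                 trans (sym (cong proj₁ p≡)) (cong proj₁ p≡′))

insertedPartitions-unique : ∀ n → Unique (insertedPartitions n)
insertedPartitions-unique n =
  Unique-concatMap⁺ (λ i → map (λ ρ → insert i ρ , i) (partitions (n ∸ i)))
    (Unique.map⁺ ℕP.suc-injective (Unique.upTo⁺ n))
    (λ i → Unique.map⁺ (insert-injective i ∘ Product.,-injectiveˡ) (partitions-unique (n ∸ i)))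
    (λ p∈ p∈′ → let _ , _ , p≡ = ∈-map⁻ _ p∈ ; _ , _ , p≡′ = ∈-map⁻ _ p∈′ in
                 trans (sym (cong proj₂ p≡)) (cong proj₂ p≡′))
  where
  insert-injective : ∀ i {ρ ρ′} → insert i ρ ≡ insert i ρ′ → ρ ≡ ρ′
  insert-injective i {ρ} {ρ′} eq =
    trans (sym (removeOne-insert i ρ)) (trans (cong (removeOne i) eq) (removeOne-insert i ρ′))

marked⊆inserted : ∀ n {p} → p ∈ markedPartitions n → p ∈ insertedPartitions n
marked⊆inserted n p∈
  with ν , ν∈ , νi∈ ← find (∈-concatMap⁻ (λ ν → map (ν ,_) (distinctParts ν)) {xs = partitions n} p∈)
  with i , i∈ , refl ← ∈-map⁻ (ν ,_) νi∈
  with ν-part , refl ← partitions-sound {n} ν∈ =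
  ∈-concatMap⁺ (λ i → map (λ ρ → insert i ρ , i) (partitions (size ν ∸ i)))
    (lose (i∈1…n (All.lookup (proj₁ ν-part) i∈ν) (∈⇒≤size ν i∈ν))
          (subst (λ ν′ → (ν′ , i) ∈ map (λ ρ → insert i ρ , i) (partitions (size ν ∸ i))) (insert-removeOne ν-part i∈ν) (∈-map⁺ (λ ρ → insert i ρ , i) ρ∈)))
  where
  i∈ν : i ∈ ν
  i∈ν = ∈-deduplicate⁻ ℕ._≟_ ν i∈
  i∈1…n : ∀ {i n} → 1 ≤ i → i ≤ n → i ∈ map suc (upTo n)
  i∈1…n {suc i} _ i<n = ∈-map⁺ suc (∈-upTo⁺ i<n)
  ρ∈ : removeOne i ν ∈ partitions (size ν ∸ i)
  ρ∈ = subst (λ m → removeOne i ν ∈ partitions m)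
             (trans (sym (ℕP.m+n∸m≡n i _)) (cong (_∸ i) (size-removeOne i∈ν)))
             (partitions-complete (IsPartition-removeOne i ν-part))

inserted⊆marked : ∀ n {p} → p ∈ insertedPartitions n → p ∈ markedPartitions n
inserted⊆marked n p∈
  with i , i∈ , iρ∈ ← find (∈-concatMap⁻ (λ i → map (λ ρ → insert i ρ , i) (partitions (n ∸ i)))
                                          {xs = map suc (upTo n)} p∈)
  with ρ , ρ∈ , refl ← ∈-map⁻ (λ ρ → insert i ρ , i) iρ∈
  with j , j∈ , refl ← ∈-map⁻ suc i∈
  with ρ-part , ρ-size ← partitions-sound {n ∸ suc j} ρ∈ =
  ∈-concatMap⁺ (λ ν → map (ν ,_) (distinctParts ν))
    (lose ν∈ (∈-map⁺ (insert (suc j) ρ ,_) (∈-deduplicate⁺ ℕ._≟_ (∈-insert (suc j) ρ))))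
  where
  ν∈ : insert (suc j) ρ ∈ partitions n
  ν∈ = subst (λ m → insert (suc j) ρ ∈ partitions m)
             (trans (size-insert (suc j) ρ) (trans (cong (suc j ℕ.+_) ρ-size) (ℕP.m+[n∸m]≡n (∈-upTo⁻ j∈))))
             (partitions-complete (IsPartition-insert (s≤s z≤n) ρ-part))

∑-markedPartitions : ∀ n (H : List ℕ × ℕ → ℚ) →
  ∑ (λ ν → ∑ (λ i → H (ν , i)) (distinctParts ν)) (partitions n)
    ≡ ∑ (λ i → ∑ (λ ρ → H (insert i ρ , i)) (partitions (n ∸ i))) (map suc (upTo n))
∑-markedPartitions n H = begin
  ∑ (λ ν → ∑ (λ i → H (ν , i)) (distinctParts ν)) (partitions n)
    ≡⟨ ∑-cong (partitions n) (λ ν → ∑-map H (ν ,_) (distinctParts ν)) ⟨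
  ∑ (λ ν → ∑ H (map (ν ,_) (distinctParts ν))) (partitions n)
    ≡⟨ ∑-concatMap H (λ ν → map (ν ,_) (distinctParts ν)) (partitions n) ⟨
  ∑ H (markedPartitions n)
    ≡⟨ ∑-Unique-same-elements H (markedPartitions-unique n) (insertedPartitions-unique n) (marked⊆inserted n) (inserted⊆marked n) ⟩
  ∑ H (insertedPartitions n)
    ≡⟨ ∑-concatMap H (λ i → map (λ ρ → insert i ρ , i) (partitions (n ∸ i))) (map suc (upTo n)) ⟩
  ∑ (λ i → ∑ H (map (λ ρ → insert i ρ , i) (partitions (n ∸ i)))) (map suc (upTo n))
    ≡⟨ ∑-cong (map suc (upTo n)) (λ i → ∑-map H (λ ρ → insert i ρ , i) (partitions (n ∸ i))) ⟩
  ∑ (λ i → ∑ (λ ρ → H (insert i ρ , i)) (partitions (n ∸ i))) (map suc (upTo n))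
    ∎
  where open ≡-Reasoning

-- The transition matrix pm from power sums to monomials

if-≤-∸ : ∀ l c s x → (if does (l ≤? c) then (if does (s ≟ c ∸ l) then x else 0) else 0)
                   ≡ (if does (s ℕ.+ l ≟ c) then x else 0)
if-≤-∸ l c s x with l ≤? c
... | no l≰c rewrite dec-false (l ≤? c) l≰c
                    | dec-false (s ℕ.+ l ≟ c) (λ s+l≡c → l≰c (subst (l ≤_) s+l≡c (ℕP.m≤n+m l s))) = refl
... | yes l≤c rewrite dec-true (l ≤? c) l≤c with s ≟ c ∸ l
...   | yes s≡c∸l rewrite dec-true (s ≟ c ∸ l) s≡c∸l
                        | dec-true (s ℕ.+ l ≟ c) (trans (cong (ℕ._+ l) s≡c∸l) (ℕP.m∸n+n≡m l≤c)) = refl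
...   | no s≢c∸l rewrite dec-false (s ≟ c ∸ l) s≢c∸l
                       | dec-false (s ℕ.+ l ≟ c) (λ s+l≡c → s≢c∸l (trans (sym (ℕP.m+n∸n≡m s l)) (cong (_∸ l) s+l≡c))) = refl

pm-cons-splits : ∀ λ′ c cs →
                 pm λ′ (c ∷ cs) ≡ ℕ∑.∑ (λ p → if does (proj₁ p ≟ c) then pm (proj₂ p) cs else 0) (splits λ′)
pm-cons-splits [] zero cs = sym (ℕP.+-identityʳ _)
pm-cons-splits [] (suc c) cs = refl
pm-cons-splits (l ∷ λ′) c cs = begin
  ℕ∑.∑ (pm λ′) (now ++ later)
    ≡⟨ ℕ∑.∑-++ (pm λ′) now later ⟩
  ℕ∑.∑ (pm λ′) now ℕ.+ ℕ∑.∑ (pm λ′) later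
    ≡⟨ cong₂ ℕ._+_ into-now into-later ⟩
  ℕ∑.∑ (F ∘ map₁ (ℕ._+ l)) (splits λ′) ℕ.+ ℕ∑.∑ (F ∘ map₂ (l ∷_)) (splits λ′)
    ≡⟨ cong₂ ℕ._+_ (ℕ∑.∑-map F (map₁ (ℕ._+ l)) (splits λ′)) (ℕ∑.∑-map F (map₂ (l ∷_)) (splits λ′)) ⟨
  ℕ∑.∑ F (map (map₁ (ℕ._+ l)) (splits λ′)) ℕ.+ ℕ∑.∑ F (map (map₂ (l ∷_)) (splits λ′))
    ≡⟨ ℕ∑.∑-++ F (map (map₁ (ℕ._+ l)) (splits λ′)) _ ⟨
  ℕ∑.∑ F (splits (l ∷ λ′))
    ∎
  where
  open ≡-Reasoning
  now later : List (List ℕ)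
  now = if does (l ≤? c) then ((c ∸ l) ∷ cs) ∷ [] else []
  later = map (c ∷_) (choices l cs)
  F : ℕ × List ℕ → ℕ
  F p = if does (proj₁ p ≟ c) then pm (proj₂ p) cs else 0
  into-now : ℕ∑.∑ (pm λ′) now ≡ ℕ∑.∑ (F ∘ map₁ (ℕ._+ l)) (splits λ′)
  into-now = begin
    ℕ∑.∑ (pm λ′) now
      ≡⟨ ℕ∑-if-singleton ((c ∸ l) ∷ cs) (does (l ≤? c)) (pm λ′) ⟩
    (if does (l ≤? c) then pm λ′ ((c ∸ l) ∷ cs) else 0)
      ≡⟨ cong (λ n → if does (l ≤? c) then n else 0) (pm-cons-splits λ′ (c ∸ l) cs) ⟩
    (if does (l ≤? c) then ℕ∑.∑ (λ p → if does (proj₁ p ≟ c ∸ l) then pm (proj₂ p) cs else 0) (splits λ′) else 0)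
      ≡⟨ ℕ∑-if (does (l ≤? c)) _ (splits λ′) ⟨
    ℕ∑.∑ (λ p → if does (l ≤? c) then (if does (proj₁ p ≟ c ∸ l) then pm (proj₂ p) cs else 0) else 0) (splits λ′)
      ≡⟨ ℕ∑.∑-cong (splits λ′) (λ p → if-≤-∸ l c (proj₁ p) (pm (proj₂ p) cs)) ⟩
    ℕ∑.∑ (F ∘ map₁ (ℕ._+ l)) (splits λ′)
      ∎
  into-later : ℕ∑.∑ (pm λ′) later ≡ ℕ∑.∑ (F ∘ map₂ (l ∷_)) (splits λ′)
  into-later = begin
    ℕ∑.∑ (pm λ′) later
      ≡⟨ ℕ∑.∑-map (pm λ′) (c ∷_) (choices l cs) ⟩
    ℕ∑.∑ (λ ch → pm λ′ (c ∷ ch)) (choices l cs)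
      ≡⟨ ℕ∑.∑-cong (choices l cs) (λ ch → pm-cons-splits λ′ c ch) ⟩
    ℕ∑.∑ (λ ch → ℕ∑.∑ (λ p → if does (proj₁ p ≟ c) then pm (proj₂ p) ch else 0) (splits λ′)) (choices l cs)
      ≡⟨ ℕ∑.∑-comm (λ ch p → if does (proj₁ p ≟ c) then pm (proj₂ p) ch else 0) (choices l cs) (splits λ′) ⟩
    ℕ∑.∑ (λ p → ℕ∑.∑ (λ ch → if does (proj₁ p ≟ c) then pm (proj₂ p) ch else 0) (choices l cs)) (splits λ′)
      ≡⟨ ℕ∑.∑-cong (splits λ′) (λ p → ℕ∑-if (does (proj₁ p ≟ c)) (pm (proj₂ p)) (choices l cs)) ⟩
    ℕ∑.∑ (F ∘ map₂ (l ∷_)) (splits λ′)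
      ∎

pm-cons-cong : ∀ λ′ c {cs cs′} → (∀ μ → pm μ cs ≡ pm μ cs′) → pm λ′ (c ∷ cs) ≡ pm λ′ (c ∷ cs′)
pm-cons-cong λ′ c {cs} {cs′} pm-cs≡ = begin
  pm λ′ (c ∷ cs)
    ≡⟨ pm-cons-splits λ′ c cs ⟩
  ℕ∑.∑ (λ p → if does (proj₁ p ≟ c) then pm (proj₂ p) cs else 0) (splits λ′)
    ≡⟨ ℕ∑.∑-cong (splits λ′) (λ p → cong (λ n → if does (proj₁ p ≟ c) then n else 0) (pm-cs≡ (proj₂ p))) ⟩
  ℕ∑.∑ (λ p → if does (proj₁ p ≟ c) then pm (proj₂ p) cs′ else 0) (splits λ′)
    ≡⟨ pm-cons-splits λ′ c cs′ ⟨
  pm λ′ (c ∷ cs′)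
    ∎
  where open ≡-Reasoning

∑-choices-∷-∷ : ∀ (f : List ℕ → ℕ) l a b cs →
                ℕ∑.∑ f (choices l (a ∷ b ∷ cs))
                  ≡ (if does (l ≤? a) then f ((a ∸ l) ∷ b ∷ cs) else 0)
                    ℕ.+ ((if does (l ≤? b) then f (a ∷ (b ∸ l) ∷ cs) else 0)
                    ℕ.+ ℕ∑.∑ (λ ch → f (a ∷ b ∷ ch)) (choices l cs))
∑-choices-∷-∷ f l a b cs =
  trans (ℕ∑.∑-++ f (if does (l ≤? a) then ((a ∸ l) ∷ b ∷ cs) ∷ [] else []) (map (a ∷_) (choices l (b ∷ cs))))
  (cong₂ ℕ._+_ (ℕ∑-if-singleton ((a ∸ l) ∷ b ∷ cs) (does (l ≤? a)) f)
  (trans (ℕ∑.∑-map f (a ∷_) (choices l (b ∷ cs)))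
  (trans (ℕ∑.∑-++ (f ∘ (a ∷_)) (if does (l ≤? b) then ((b ∸ l) ∷ cs) ∷ [] else []) (map (b ∷_) (choices l cs)))
  (cong₂ ℕ._+_ (ℕ∑-if-singleton ((b ∸ l) ∷ cs) (does (l ≤? b)) (f ∘ (a ∷_))) (ℕ∑.∑-map (f ∘ (a ∷_)) (b ∷_) (choices l cs))))))

∧-swap : ∀ x y z → x ∧ (y ∧ z) ≡ y ∧ (x ∧ z)
∧-swap true y z = refl
∧-swap false true z = refl
∧-swap false false z = refl

pm-swap : ∀ λ′ a b cs → pm λ′ (a ∷ b ∷ cs) ≡ pm λ′ (b ∷ a ∷ cs)
pm-swap [] a b cs = cong (λ z → if z then 1 else 0) (∧-swap (does (a ≟ 0)) (does (b ≟ 0)) (allZero cs))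
pm-swap (l ∷ λ′) a b cs = begin
  ℕ∑.∑ (pm λ′) (choices l (a ∷ b ∷ cs))
    ≡⟨ ∑-choices-∷-∷ (pm λ′) l a b cs ⟩
  (if does (l ≤? a) then pm λ′ ((a ∸ l) ∷ b ∷ cs) else 0)
    ℕ.+ ((if does (l ≤? b) then pm λ′ (a ∷ (b ∸ l) ∷ cs) else 0)
    ℕ.+ ℕ∑.∑ (λ ch → pm λ′ (a ∷ b ∷ ch)) (choices l cs))
    ≡⟨ cong₂ ℕ._+_ (cong (λ n → if does (l ≤? a) then n else 0) (pm-swap λ′ (a ∸ l) b cs))
                   (cong₂ ℕ._+_ (cong (λ n → if does (l ≤? b) then n else 0) (pm-swap λ′ a (b ∸ l) cs))
                                (ℕ∑.∑-cong (choices l cs) (λ ch → pm-swap λ′ a b ch))) ⟩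
  (if does (l ≤? a) then pm λ′ (b ∷ (a ∸ l) ∷ cs) else 0)
    ℕ.+ ((if does (l ≤? b) then pm λ′ ((b ∸ l) ∷ a ∷ cs) else 0)
    ℕ.+ ℕ∑.∑ (λ ch → pm λ′ (b ∷ a ∷ ch)) (choices l cs))
    ≡⟨ ℕ+.x∙yz≈y∙xz (if does (l ≤? a) then pm λ′ (b ∷ (a ∸ l) ∷ cs) else 0)
                    (if does (l ≤? b) then pm λ′ ((b ∸ l) ∷ a ∷ cs) else 0) _ ⟩
  (if does (l ≤? b) then pm λ′ ((b ∸ l) ∷ a ∷ cs) else 0)
    ℕ.+ ((if does (l ≤? a) then pm λ′ (b ∷ (a ∸ l) ∷ cs) else 0)
    ℕ.+ ℕ∑.∑ (λ ch → pm λ′ (b ∷ a ∷ ch)) (choices l cs))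
    ≡⟨ ∑-choices-∷-∷ (pm λ′) l b a cs ⟨
  ℕ∑.∑ (pm λ′) (choices l (b ∷ a ∷ cs))
    ∎
  where open ≡-Reasoning

pm-↭ : ∀ λ′ {cs cs′} → cs ↭ cs′ → pm λ′ cs ≡ pm λ′ cs′
pm-↭ λ′ _↭_.refl = refl
pm-↭ λ′ (prep c cs↭cs′) = pm-cons-cong λ′ c (λ μ → pm-↭ μ cs↭cs′)
pm-↭ λ′ (swap a b cs↭cs′) =
  trans (pm-cons-cong λ′ a (λ μ → pm-cons-cong μ b (λ ν → pm-↭ ν cs↭cs′))) (pm-swap λ′ a b _)
pm-↭ λ′ (_↭_.trans cs↭ cs′↭) = trans (pm-↭ λ′ cs↭) (pm-↭ λ′ cs′↭)

pm-insert : ∀ λ′ i ρ → pm λ′ (insert i ρ) ≡ pm λ′ (i ∷ ρ)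
pm-insert λ′ i ρ = pm-↭ λ′ (insert-↭ i ρ)

dropZeros : List ℕ → List ℕ
dropZeros [] = []
dropZeros (zero ∷ cs) = dropZeros cs
dropZeros (suc c ∷ cs) = suc c ∷ dropZeros cs

dropZeros-positive : ∀ {ν} → All (1 ≤_) ν → dropZeros ν ≡ ν
dropZeros-positive [] = refl
dropZeros-positive {suc x ∷ _} (_ ∷ pos) = cong (suc x ∷_) (dropZeros-positive pos)

allZero⇒dropZeros≡[] : ∀ cs → allZero cs ≡ true → dropZeros cs ≡ []
allZero⇒dropZeros≡[] [] _ = refl
allZero⇒dropZeros≡[] (zero ∷ cs) all0 = allZero⇒dropZeros≡[] cs all0
allZero⇒dropZeros≡[] (suc c ∷ cs) ()

-- In pm the list caps holds the remaining capacities of the bins, and dropZeros caps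
-- the bins that are not yet full.
BinsShrink : ℕ → List ℕ → List ℕ → Set
BinsShrink l caps ch =
  length (dropZeros caps) ≤ suc (length (dropZeros ch)) ×
  (length (dropZeros caps) ≡ suc (length (dropZeros ch)) → l ∷ dropZeros ch ↭ dropZeros caps)

∈-choices⁻ : ∀ l caps {ch} → 1 ≤ l → ch ∈ choices l caps → BinsShrink l caps ch
∈-choices⁻ l (c ∷ cs) 1≤l ch∈ with ∈-++⁻ (if does (l ≤? c) then ((c ∸ l) ∷ cs) ∷ [] else []) ch∈
... | inj₁ ch∈now with l≤c , refl ← ∈-if-[]⁻ (l ≤? c) ch∈now = fill c 1≤l l≤c
  where
  fill : ∀ c → 1 ≤ l → l ≤ c → BinsShrink l (c ∷ cs) ((c ∸ l) ∷ cs)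
  fill zero (s≤s _) ()
  fill (suc c) 1≤l l≤c with suc c ∸ l in eq
  ... | zero = ℕP.≤-refl , λ _ → subst (λ x → x ∷ dropZeros cs ↭ suc c ∷ dropZeros cs)
                                        (ℕP.≤-antisym (ℕP.m∸n≡0⇒m≤n eq) l≤c) ↭-refl
  ... | suc _ = ℕP.n≤1+n _ , λ eq′ → ⊥-elim (ℕP.1+n≢n (sym (ℕP.suc-injective eq′)))
... | inj₂ ch∈later with ch′ , ch′∈ , refl ← ∈-map⁻ (c ∷_) ch∈later
                    with shrinks , exact ← ∈-choices⁻ l cs 1≤l ch′∈ = extend c
  where
  extend : ∀ c → BinsShrink l (c ∷ cs) (c ∷ ch′)
  extend zero = shrinks , exact
  extend (suc c) = s≤s shrinks , λ eq → ↭-trans (swap l (suc c) ↭-refl) (prep (suc c) (exact (ℕP.suc-injective eq)))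

pm≢0⇒dropZeros-shorter : ∀ λ′ caps → All (1 ≤_) λ′ → pm λ′ caps ≢ 0 →
                         length (dropZeros caps) ≤ length λ′ ×
                         (length (dropZeros caps) ≡ length λ′ → λ′ ↭ dropZeros caps)
pm≢0⇒dropZeros-shorter [] caps _ pm≢0 with allZero caps in all0
... | true rewrite allZero⇒dropZeros≡[] caps all0 = z≤n , λ _ → ↭-refl
... | false = ⊥-elim (pm≢0 refl)
pm≢0⇒dropZeros-shorter (l ∷ λ′) caps (1≤l ∷ pos) pm≢0
  with ch , ch∈ , pm≢0′ ← ℕ∑-≢0⇒∃ (pm λ′) (choices l caps) pm≢0
  with ch-shorter , ch-exact ← pm≢0⇒dropZeros-shorter λ′ ch pos pm≢0′
  with caps-shrinks , caps-exact ← ∈-choices⁻ l caps 1≤l ch∈ =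
  ℕP.≤-trans caps-shrinks (s≤s ch-shorter) , λ eq →
    let ch≡ = ℕP.≤-antisym ch-shorter (ℕ.s≤s⁻¹ (subst (_≤ suc (length (dropZeros ch))) eq caps-shrinks))
    in ↭-trans (prep l (ch-exact ch≡)) (caps-exact (trans eq (cong suc (sym ch≡))))

pm-triangular : ∀ {λ′ ν} → IsPartition λ′ → IsPartition ν → pm λ′ ν ≢ 0 → ν ≡ λ′ ⊎ length ν < length λ′
pm-triangular {λ′} {ν} (λ-pos , λ-dec) (ν-pos , ν-dec) pm≢0
  with shorter , exact ← pm≢0⇒dropZeros-shorter λ′ ν λ-pos pm≢0
  rewrite dropZeros-positive ν-pos
  with length ν ≟ length λ′
... | yes eq = inj₁ (sym (Decreasing-↭ λ-dec ν-dec (exact eq)))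
... | no neq = inj₂ (ℕP.≤∧≢⇒< shorter neq)

pm-0∷ : ∀ λ′ cs → All (1 ≤_) λ′ → pm λ′ (0 ∷ cs) ≡ pm λ′ cs
pm-0∷ [] cs _ = refl
pm-0∷ (suc l ∷ λ′) cs (_ ∷ pos) =
  trans (ℕ∑.∑-map (pm λ′) (0 ∷_) (choices (suc l) cs)) (ℕ∑.∑-cong (choices (suc l) cs) (λ ch → pm-0∷ λ′ ch pos))

pm-diagonal : ∀ λ′ → All (1 ≤_) λ′ → 1 ≤ pm λ′ λ′
pm-diagonal [] _ = s≤s z≤n
pm-diagonal (l ∷ λ′) (_ ∷ pos) rewrite dec-true (l ≤? l) ℕP.≤-refl | ℕP.n∸n≡0 l =
  ℕP.≤-trans (subst (1 ≤_) (sym (pm-0∷ λ′ λ′ pos)) (pm-diagonal λ′ pos)) (ℕP.m≤m+n _ _)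

-- Induction on the number of parts of μ: by pm-triangular, pairing with p_μ sees only
-- d μ and the values of d on partitions with fewer parts.
pm-pairing-injective : ∀ n (d : List ℕ → ℚ) →
  (∀ {λ′} → λ′ ∈ partitions n → ∑ (λ ν → ℕ→ℚ (pm λ′ ν) * d ν) (partitions n) ≡ 0ℚ) →
  ∀ {μ} → μ ∈ partitions n → d μ ≡ 0ℚ
pm-pairing-injective n d pairing≡0 {μ} = vanish (suc (length μ)) ℕP.≤-refl
  where
  vanish : ∀ k {μ} → length μ < k → μ ∈ partitions n → d μ ≡ 0ℚ
  vanish (suc k) {μ} μ<k μ∈ = x*y≡0⇒y≡0 _ _ pm-μμ≢0 (trans (sym diagonal) (pairing≡0 μ∈))
    where
    μ-part : IsPartition μ
    μ-part = proj₁ (partitions-sound {n} μ∈)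
    pm-μμ≢0 : ℕ→ℚ (pm μ μ) ≢ 0ℚ
    pm-μμ≢0 with pm μ μ | pm-diagonal μ (proj₁ μ-part)
    ... | suc m | _ = ℕ→ℚ-suc≢0 m
    off-diagonal : ∀ {ν} → ν ∈ partitions n → ν ≢ μ → ℕ→ℚ (pm μ ν) * d ν ≡ 0ℚ
    off-diagonal {ν} ν∈ ν≢μ with pm μ ν ≟ 0
    ... | yes pm≡0 rewrite pm≡0 = ℚP.*-zeroˡ (d ν)
    ... | no pm≢0 with pm-triangular μ-part (proj₁ (partitions-sound {n} ν∈)) pm≢0
    ...   | inj₁ ν≡μ = ⊥-elim (ν≢μ ν≡μ)
    ...   | inj₂ ν<μ rewrite vanish k (ℕP.≤-trans ν<μ (ℕ.s≤s⁻¹ μ<k)) ν∈ = ℚP.*-zeroʳ (ℕ→ℚ (pm μ ν))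
    diagonal : ∑ (λ ν → ℕ→ℚ (pm μ ν) * d ν) (partitions n) ≡ ℕ→ℚ (pm μ μ) * d μ
    diagonal = ∑-single (λ ν → ℕ→ℚ (pm μ ν) * d ν) (partitions-unique n) μ∈ off-diagonal

ℕ→ℚ-pm-cons : ∀ λ′ i ρ →
  ℕ→ℚ (pm λ′ (i ∷ ρ)) ≡ ∑ (λ p → 𝟙 (does (proj₁ p ≟ i)) * ℕ→ℚ (pm (proj₂ p) ρ)) (splits λ′)
ℕ→ℚ-pm-cons λ′ i ρ =
  trans (cong ℕ→ℚ (pm-cons-splits λ′ i ρ))
  (trans (ℕ→ℚ-∑ (λ p → if does (proj₁ p ≟ i) then pm (proj₂ p) ρ else 0) (splits λ′))
         (∑-cong (splits λ′) (λ p → ℕ→ℚ-if (does (proj₁ p ≟ i)) (pm (proj₂ p) ρ))))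

-- Pairing both sides with the power sums

pairing-rhs-reindex : ∀ (mB : List ℕ → Series) λ′ a b →
  ∑ (λ ν → ℕ→ℚ (pm λ′ ν) * Σₛ (map (λ i → (1ₛ ⊖ mono 0 i) ⊛ mB (removeOne i ν)) (distinctParts ν)) a b)
    (partitions (size λ′))
    ≡ ∑ (λ i → ((1ₛ ⊖ mono 0 i) ⊛ Σₛ (map (λ ρ → ℕ→ℚ (pm λ′ (i ∷ ρ)) · mB ρ) (partitions (size λ′ ∸ i)))) a b)
        (map suc (upTo (size λ′)))
pairing-rhs-reindex mB λ′ a b = begin
  ∑ (λ ν → c ν * Σₛ (map (λ i → T i ⊛ mB (removeOne i ν)) (distinctParts ν)) a b) (partitions n)
    ≡⟨ ∑-cong (partitions n) (λ ν →
         trans (cong (c ν *_) (Σₛ-map-apply (λ i → T i ⊛ mB (removeOne i ν)) (distinctParts ν) a b))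
               (∑-*ˡ (c ν) (λ i → (T i ⊛ mB (removeOne i ν)) a b) (distinctParts ν))) ⟩
  ∑ (λ ν → ∑ (λ i → c ν * (T i ⊛ mB (removeOne i ν)) a b) (distinctParts ν)) (partitions n)
    ≡⟨ ∑-markedPartitions n (λ p → c (proj₁ p) * (T (proj₂ p) ⊛ mB (removeOne (proj₂ p) (proj₁ p))) a b) ⟩
  ∑ (λ i → ∑ (λ ρ → c (insert i ρ) * (T i ⊛ mB (removeOne i (insert i ρ))) a b) (partitions (n ∸ i))) 1…n
    ≡⟨ ∑-cong 1…n (λ i → ∑-cong (partitions (n ∸ i)) (λ ρ →
         cong₂ (λ m ν → ℕ→ℚ m * (T i ⊛ mB ν) a b) (pm-insert λ′ i ρ) (removeOne-insert i ρ))) ⟩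
  ∑ (λ i → ∑ (λ ρ → ℕ→ℚ (pm λ′ (i ∷ ρ)) * (T i ⊛ mB ρ) a b) (partitions (n ∸ i))) 1…n
    ≡⟨ ∑-cong 1…n (λ i → ⊛-Σₛ-·-apply (T i) (λ ρ → ℕ→ℚ (pm λ′ (i ∷ ρ))) mB (partitions (n ∸ i)) a b) ⟨
  ∑ (λ i → (T i ⊛ Σₛ (map (λ ρ → ℕ→ℚ (pm λ′ (i ∷ ρ)) · mB ρ) (partitions (n ∸ i)))) a b) 1…n
    ∎
  where
  open ≡-Reasoning
  n : ℕ
  n = size λ′
  1…n : List ℕ
  1…n = map suc (upTo n)
  c : List ℕ → ℚ
  c ν = ℕ→ℚ (pm λ′ ν)
  T : ℕ → Series
  T i = 1ₛ ⊖ mono 0 i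

∑-1…n-splits-pB : ∀ λ′ → All (1 ≤_) λ′ → ∀ a b →
  ∑ (λ i → ((1ₛ ⊖ mono 0 i) ⊛ Σₛ (map (λ p → 𝟙 (does (proj₁ p ≟ i)) · Πₛ (map pB (proj₂ p))) (splits λ′))) a b)
    (map suc (upTo (size λ′)))
    ≡ ((1ₛ ⊖ mono (size λ′) 0) ⊛ Πₛ (map pA λ′)) a b
∑-1…n-splits-pB λ′ pos a b = begin
  ∑ (λ i → (T i ⊛ Σₛ (map (λ p → δ i p · Π (proj₂ p)) (splits λ′))) a b) 1…n
    ≡⟨ ∑-cong 1…n (λ i → ⊛-Σₛ-·-apply (T i) (δ i) (Π ∘ proj₂) (splits λ′) a b) ⟩
  ∑ (λ i → ∑ (λ p → δ i p * (T i ⊛ Π (proj₂ p)) a b) (splits λ′)) 1…n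
    ≡⟨ ∑-comm (λ i p → δ i p * (T i ⊛ Π (proj₂ p)) a b) 1…n (splits λ′) ⟩
  ∑ (λ p → ∑ (λ i → δ i p * (T i ⊛ Π (proj₂ p)) a b) 1…n) (splits λ′)
    ≡⟨ ∑-cong-∈ (splits λ′) (λ {p} p∈ →
         ∑-1…n-δ n (proj₁ p) (λ i → (T i ⊛ Π (proj₂ p)) a b) (s≤n p∈) (T0⊛≡0 (Π (proj₂ p)))) ⟩
  ∑ (λ p → (T (proj₁ p) ⊛ Π (proj₂ p)) a b) (splits λ′)
    ≡⟨ Σₛ-map-apply (λ p → T (proj₁ p) ⊛ Π (proj₂ p)) (splits λ′) a b ⟨
  Σₛ (map (λ p → T (proj₁ p) ⊛ Π (proj₂ p)) (splits λ′)) a b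
    ≡⟨ Σₛ-splits-pB λ′ pos a b ⟩
  ((1ₛ ⊖ mono n 0) ⊛ Πₛ (map pA λ′)) a b
    ∎
  where
  open ≡-Reasoning
  n : ℕ
  n = size λ′
  1…n : List ℕ
  1…n = map suc (upTo n)
  T : ℕ → Series
  T i = 1ₛ ⊖ mono 0 i
  δ : ℕ → ℕ × List ℕ → ℚ
  δ i p = 𝟙 (does (proj₁ p ≟ i))
  Π : List ℕ → Series
  Π r = Πₛ (map pB r)
  s≤n : ∀ {p} → p ∈ splits λ′ → proj₁ p ≤ n
  s≤n {s , r} p∈ = subst (s ≤_) (proj₂ (∈-splits⁻ λ′ p∈)) (ℕP.m≤m+n s (size r))
  T0⊛≡0 : ∀ g → (T 0 ⊛ g) a b ≡ 0ℚ
  T0⊛≡0 g = trans (⊛-distribʳ-⊖ 1ₛ 1ₛ g a b) (ℚP.+-inverseʳ ((1ₛ ⊛ g) a b))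

module _ {mB : List ℕ → Series} (hB : IsMonomialImage pB mB) where

  Σₛ-pm-cons-mB : ∀ {λ′} → IsPartition λ′ → ∀ i →
    Σₛ (map (λ ρ → ℕ→ℚ (pm λ′ (i ∷ ρ)) · mB ρ) (partitions (size λ′ ∸ i)))
      ≈ Σₛ (map (λ p → 𝟙 (does (proj₁ p ≟ i)) · Πₛ (map pB (proj₂ p))) (splits λ′))
  Σₛ-pm-cons-mB {λ′} λ-part i a b = begin
    Σₛ (map (λ ρ → ℕ→ℚ (pm λ′ (i ∷ ρ)) · mB ρ) P) a b
      ≡⟨ Σₛ-map-apply (λ ρ → ℕ→ℚ (pm λ′ (i ∷ ρ)) · mB ρ) P a b ⟩
    ∑ (λ ρ → ℕ→ℚ (pm λ′ (i ∷ ρ)) * mB ρ a b) P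
      ≡⟨ ∑-cong P (λ ρ → trans (cong (_* mB ρ a b) (ℕ→ℚ-pm-cons λ′ i ρ)) (∑-*ʳ (mB ρ a b) (δpm ρ) S)) ⟩
    ∑ (λ ρ → ∑ (λ p → δpm ρ p * mB ρ a b) S) P
      ≡⟨ ∑-comm (λ ρ p → δpm ρ p * mB ρ a b) P S ⟩
    ∑ (λ p → ∑ (λ ρ → δpm ρ p * mB ρ a b) P) S
      ≡⟨ ∑-cong S (λ p → trans (∑-cong P (λ ρ → ℚP.*-assoc (δ p) _ _)) (sym (∑-*ˡ (δ p) _ P))) ⟩
    ∑ (λ p → δ p * ∑ (λ ρ → ℕ→ℚ (pm (proj₂ p) ρ) * mB ρ a b) P) S
      ≡⟨ ∑-cong-∈ S select ⟩
    ∑ (λ p → δ p * Πₛ (map pB (proj₂ p)) a b) S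
      ≡⟨ Σₛ-map-apply (λ p → δ p · Πₛ (map pB (proj₂ p))) S a b ⟨
    Σₛ (map (λ p → δ p · Πₛ (map pB (proj₂ p))) S) a b
      ∎
    where
    open ≡-Reasoning
    P : List (List ℕ)
    P = partitions (size λ′ ∸ i)
    S : List (ℕ × List ℕ)
    S = splits λ′
    δ : ℕ × List ℕ → ℚ
    δ p = 𝟙 (does (proj₁ p ≟ i))
    δpm : List ℕ → ℕ × List ℕ → ℚ
    δpm ρ p = δ p * ℕ→ℚ (pm (proj₂ p) ρ)
    select : ∀ {p} → p ∈ S → δ p * ∑ (λ ρ → ℕ→ℚ (pm (proj₂ p) ρ) * mB ρ a b) P ≡ δ p * Πₛ (map pB (proj₂ p)) a b
    select {s , r} p∈ with s ≟ i
    ... | no s≢i = trans (𝟙-≢-* s i _ s≢i) (sym (𝟙-≢-* s i _ s≢i))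
    ... | yes refl = cong (𝟙 (does (s ≟ s)) *_) (begin
      ∑ (λ ρ → ℕ→ℚ (pm r ρ) * mB ρ a b) (partitions (size λ′ ∸ s))
        ≡⟨ cong (λ m → ∑ (λ ρ → ℕ→ℚ (pm r ρ) * mB ρ a b) (partitions m)) size-r ⟩
      ∑ (λ ρ → ℕ→ℚ (pm r ρ) * mB ρ a b) (partitions (size r))
        ≡⟨ Σₛ-map-apply (λ ρ → ℕ→ℚ (pm r ρ) · mB ρ) (partitions (size r)) a b ⟨
      Σₛ (map (λ ρ → ℕ→ℚ (pm r ρ) · mB ρ) (partitions (size r))) a b
        ≡⟨ hB r (IsPartition-resp-⊆ r⊆λ λ-part) a b ⟨
      Πₛ (map pB r) a b
        ∎)
      where
      r⊆λ : r ⊆ λ′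
      r⊆λ = proj₁ (∈-splits⁻ λ′ p∈)
      size-r : size λ′ ∸ s ≡ size r
      size-r = trans (cong (_∸ s) (sym (proj₂ (∈-splits⁻ λ′ p∈)))) (ℕP.m+n∸m≡n s (size r))

  pairing-rhs : ∀ {λ′} → IsPartition λ′ → ∀ a b →
    ∑ (λ ν → ℕ→ℚ (pm λ′ ν) * Σₛ (map (λ i → (1ₛ ⊖ mono 0 i) ⊛ mB (removeOne i ν)) (distinctParts ν)) a b)
      (partitions (size λ′))
      ≡ ((1ₛ ⊖ mono (size λ′) 0) ⊛ Πₛ (map pA λ′)) a b
  pairing-rhs {λ′} λ-part a b =
    trans (pairing-rhs-reindex mB λ′ a b)
    (trans (∑-cong (map suc (upTo (size λ′))) (λ i → ⊛-congʳ (1ₛ ⊖ mono 0 i) (Σₛ-pm-cons-mB λ-part i) a b))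
           (∑-1…n-splits-pB λ′ (proj₁ λ-part) a b))

pairing-lhs : ∀ {mA : List ℕ → Series} → IsMonomialImage pA mA → ∀ {λ′} → IsPartition λ′ → ∀ a b →
  ∑ (λ ν → ℕ→ℚ (pm λ′ ν) * ((1ₛ ⊖ mono (size λ′) 0) ⊛ mA ν) a b) (partitions (size λ′))
    ≡ ((1ₛ ⊖ mono (size λ′) 0) ⊛ Πₛ (map pA λ′)) a b
pairing-lhs {mA} hA {λ′} λ-part a b =
  trans (sym (⊛-Σₛ-·-apply (1ₛ ⊖ mono (size λ′) 0) (ℕ→ℚ ∘ pm λ′) mA (partitions (size λ′)) a b))
        (⊛-congʳ (1ₛ ⊖ mono (size λ′) 0) (≈-sym (hA λ′ λ-part)) a b)

pairings-agree : ∀ {mA mB : List ℕ → Series} → IsMonomialImage pA mA → IsMonomialImage pB mB →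
  ∀ {n λ′} → IsPartition λ′ → size λ′ ≡ n → ∀ a b →
  ∑ (λ ν → ℕ→ℚ (pm λ′ ν) * (((1ₛ ⊖ mono n 0) ⊛ mA ν) a b
                             ℚ.- Σₛ (map (λ i → (1ₛ ⊖ mono 0 i) ⊛ mB (removeOne i ν)) (distinctParts ν)) a b))
    (partitions n)
    ≡ 0ℚ
pairings-agree {mA} {mB} hA hB {λ′ = λ′} λ-part refl a b = begin
  ∑ (λ ν → c ν * (L ν ℚ.- R ν)) P        ≡⟨ ∑-cong P (λ ν → *-distribˡ-- (c ν) (L ν) (R ν)) ⟩
  ∑ (λ ν → c ν * L ν ℚ.- c ν * R ν) P    ≡⟨ ∑-distrib-- (λ ν → c ν * L ν) (λ ν → c ν * R ν) P ⟩
  ∑ (λ ν → c ν * L ν) P ℚ.- ∑ (λ ν → c ν * R ν) P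
    ≡⟨ cong₂ ℚ._-_ (pairing-lhs hA λ-part a b) (pairing-rhs hB λ-part a b) ⟩
  X ℚ.- X                                ≡⟨ ℚP.+-inverseʳ X ⟩
  0ℚ                                     ∎
  where
  open ≡-Reasoning
  P : List (List ℕ)
  P = partitions (size λ′)
  c L R : List ℕ → ℚ
  c ν = ℕ→ℚ (pm λ′ ν)
  L ν = ((1ₛ ⊖ mono (size λ′) 0) ⊛ mA ν) a b
  R ν = Σₛ (map (λ i → (1ₛ ⊖ mono 0 i) ⊛ mB (removeOne i ν)) (distinctParts ν)) a b
  X : ℚ
  X = ((1ₛ ⊖ mono (size λ′) 0) ⊛ Πₛ (map pA λ′)) a b

mainTheorem8 :
    (mA mB : List ℕ → Series) →
    IsMonomialImage pA mA →
    IsMonomialImage pB mB →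
    (μ : List ℕ) → IsPartition μ → μ ≢ [] →
    (1ₛ ⊖ mono (size μ) 0) ⊛ mA μ
      ≈ Σₛ (map (λ i → (1ₛ ⊖ mono 0 i) ⊛ mB (removeOne i μ)) (distinctParts μ))
mainTheorem8 mA mB hA hB μ μ-part _ a b =
  x∙y⁻¹≈ε⇒x≈y (lhs μ) (rhs μ)
    (pm-pairing-injective (size μ) (λ ν → lhs ν ℚ.- rhs ν) pairings-vanish (partitions-complete μ-part))
  where
  lhs rhs : List ℕ → ℚ
  lhs ν = ((1ₛ ⊖ mono (size μ) 0) ⊛ mA ν) a b
  rhs ν = Σₛ (map (λ i → (1ₛ ⊖ mono 0 i) ⊛ mB (removeOne i ν)) (distinctParts ν)) a b
  pairings-vanish : ∀ {λ′} → λ′ ∈ partitions (size μ) →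
                    ∑ (λ ν → ℕ→ℚ (pm λ′ ν) * (lhs ν ℚ.- rhs ν)) (partitions (size μ)) ≡ 0ℚ
  pairings-vanish λ∈ = let λ-part , λ-size = partitions-sound λ∈ in
    pairings-agree hA hB {n = size μ} λ-part λ-size a b
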